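{- Let $m,n$ be coprime positive integers with $n\ge2$, and write $m=kn+r$ with $0<r<n$. The set of alcoves $\{\omega(A_0):\omega\in\widetilde{S}_n \text{ is } m\text{ -restricted}\}$ coincides with the set of alcoves contained in the region $D_n^m\subset V$ defined by the inequalities $x_i-x_{i+r}\ge-k$ for $1\le i\le n-r$ and $x_{i+r-n}-x_i\le k+1$ for $n-r+1\le i\le n$.
   Context: Affine permutations: bijections $\omega:\mathbb{Z}\to\mathbb{Z}$ with $\omega(x+n)=\omega(x)+n$, $\sum_{i=1}^n\omega(i)=n(n+1)/2$; the group $\widetilde{S}_n$ is generated by $s_0,\ldots,s_{n-1}$ ($s_i(x)=x+1$ if $x\equiv i$, $x-1$ if $x\equiv i+1$, $x$ otherwise, mod $n$). $\omega$ is $m$-restricted if $\omega^{ -1}(x+m)>\omega^{ -1}(x)$ for all $x$. $V=\{x\in\mathbb{R}^n:\sum x_i=0\}$; $\widetilde{S}_n$ acts on $V$ with $s_i$ ($1\le i\le n-1$) swapping $x_i,x_{i+1}$ and $s_0(x_1,\ldots,x_n)=(x_n+1,x_2,\ldots,x_{n-1},x_1-1)$. Alcoves are the connected components of $V\setminus\bigcup\{x_i-x_j=\ell\}$ ($1\le i<j\le n$, $\ell\in\mathbb{Z}$); $A_0=\{x_1>x_2>\cdots>x_n>x_1-1\}$.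
   Formalization: The points of V, and so those of the alcoves, of $A_0$ and of the region $D_n^m$, have rational coordinates rather than real ones. -}

module Defs where

open import Data.Nat as ℕ using (ℕ; zero; suc; _∸_)
open import Data.Integer as ℤ using (ℤ; +_)
open import Data.Integer.DivMod using (_%ℕ_)
open import Data.Rational as ℚ using (ℚ; 0ℚ; 1ℚ; _/_)
open import Data.Fin as Fin using (Fin; toℕ; fromℕ<)
open import Data.List using (List; foldr; tabulate)
open import Data.Product using (Σ; _×_; ∃)
open import Function using (_∘_; id)
open import Relation.Nullary using (¬_; yes; no)
open import Relation.Binary.PropositionalEquality using (_≡_)

-- residue of an integer mod n (n ≥ 1 in all uses; 0 for n = 0)
res : ℕ → ℤ → ℕ
res zero    x = 0
res (suc n) x = x %ℕ (suc n)

-- the generator s_i of the affine symmetric group, as a map ℤ → ℤ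
-- (i ranges over Fin n = {0,…,n-1})
sZ : (n : ℕ) → Fin n → ℤ → ℤ
sZ n i x with res n x ℕ.≟ toℕ i
... | yes _ = x ℤ.+ ℤ.1ℤ
... | no _ with res n x ℕ.≟ res n (+ suc (toℕ i))
...   | yes _ = x ℤ.- ℤ.1ℤ
...   | no _  = x

perm : (n : ℕ) → List (Fin n) → ℤ → ℤ
perm n = foldr (λ i f → sZ n i ∘ f) id

-- ω is m-restricted: ω⁻¹(x+m) > ω⁻¹(x) for all x
Restricted : ℕ → (ℤ → ℤ) → Set
Restricted m ω = ∀ (a b x : ℤ) → ω a ≡ x → ω b ≡ x ℤ.+ (+ m) → a ℤ.< b

-- points of ℚ^n; coordinate x_{j+1} is x j for j : Fin n
Pt : ℕ → Set
Pt n = Fin n → ℚ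

-- x_{k+1} (0-based access by a natural number; 0 if out of range)
at : {n : ℕ} → Pt n → ℕ → ℚ
at {n} x k with k ℕ.<? n
... | yes p = x (fromℕ< p)
... | no _  = 0ℚ

sAct : (n : ℕ) → Fin n → Pt n → Pt n
sAct n i x j with toℕ i
... | zero with toℕ j ℕ.≟ 0
...   | yes _ = at x (n ∸ 1) ℚ.+ 1ℚ
...   | no _ with toℕ j ℕ.≟ (n ∸ 1)
...     | yes _ = at x 0 ℚ.- 1ℚ
...     | no _  = x j
sAct n i x j | suc t with toℕ j ℕ.≟ t
...   | yes _ = at x (suc t)
...   | no _ with toℕ j ℕ.≟ suc t
...     | yes _ = at x t
...     | no _  = x j

act : (n : ℕ) → List (Fin n) → Pt n → Pt n
act n w x = foldr (sAct n) x w

ℤtoℚ : ℤ → ℚ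
ℤtoℚ z = z / 1

InV : {n : ℕ} → Pt n → Set
InV x = foldr ℚ._+_ 0ℚ (tabulate x) ≡ 0ℚ

Generic : {n : ℕ} → Pt n → Set
Generic x = ∀ i j → i Fin.< j → ∀ (ℓ : ℤ) → ¬ (x i ℚ.- x j ≡ ℤtoℚ ℓ)

SameSide : {n : ℕ} → Pt n → Pt n → Set
SameSide x y = ∀ i j → i Fin.< j → ∀ (ℓ : ℤ) →
  (x i ℚ.- x j ℚ.< ℤtoℚ ℓ → y i ℚ.- y j ℚ.< ℤtoℚ ℓ) ×
  (y i ℚ.- y j ℚ.< ℤtoℚ ℓ → x i ℚ.- x j ℚ.< ℤtoℚ ℓ)

InAlcoveOf : {n : ℕ} → Pt n → Pt n → Set
InAlcoveOf p q = InV q × Generic q × SameSide p q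

InA0 : (n : ℕ) → Pt n → Set
InA0 n a = InV a × (∀ i j → toℕ j ≡ suc (toℕ i) → a j ℚ.< a i)
             × (at a 0 ℚ.- 1ℚ ℚ.< at a (n ∸ 1))

-- the region D_n^m (m = kn + r), 0-based indices
InD : (n k r : ℕ) → Pt n → Set
InD n k r x =
  (∀ (i j : Fin n) → toℕ i ℕ.+ r ≡ toℕ j → ℚ.- ℤtoℚ (+ k) ℚ.≤ x i ℚ.- x j) ×
  (∀ (i j : Fin n) → toℕ j ℕ.+ n ≡ toℕ i ℕ.+ r → x j ℚ.- x i ℚ.≤ ℤtoℚ (+ (k ℕ.+ 1)))

AlcoveIsImage : (n : ℕ) → Pt n → List (Fin n) → Set
AlcoveIsImage n p w = ∀ q →
  (InAlcoveOf p q → Σ (Pt n) λ a → InA0 n a × (∀ j → q j ≡ act n w a j)) ×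
  ((Σ (Pt n) λ a → InA0 n a × (∀ j → q j ≡ act n w a j)) → InAlcoveOf p q)

AlcoveInD : (n k r : ℕ) → Pt n → Set
AlcoveInD n k r p = ∀ q → InAlcoveOf p q → InD n k r q

{-# OPTIONS --safe #-}

-- Encode a point y of V by the sequence ext y : ℤ → ℚ, ext y (c + 1 + q n) = y c − q.  The
-- generators act compatibly on points and on ℤ, ext (s i y) (s i u) = ext y u, and A₀ consists of
-- the points whose sequence is strictly decreasing.  So for y = ω(a) with a ∈ A₀ the permutation
-- ω is m-restricted iff ext y decreases along every step u ↦ u + m.  As m = k n + r, such a step
-- takes coordinate c either to c + r, k windows further, or to c + r − n, k + 1 windows further;
-- ext y is non-increasing along these steps exactly when y satisfies the inequalities defining D.
-- Conversely, a generic point is carried into A₀ by reflecting it, as long as possible, in a wall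
-- of its alcove separating it from A₀; this lowers the number of hyperplanes x_j − x_k = ℓ
-- between the point and A₀.  Reversing the reflections gives ω with ω(A₀) the alcove of the point,
-- and if the point lies in D, then ω is m-restricted because ext of a point of A₀ strictly
-- decreases.

module Submission where

open import Defs
open import Data.Nat using (ℕ; _+_; _*_; _≤_; _<_)
open import Data.Nat.Coprimality using (Coprime)
open import Data.Fin using (Fin)
open import Data.List using (List)
open import Data.Product using (Σ; _×_)
open import Relation.Binary.PropositionalEquality using (_≡_)

import Algebra.Properties.CommutativeMonoid.Sum as Sum
open import Data.Empty using (⊥-elim)
open import Data.Fin as Fin using (zero; suc; toℕ; fromℕ<; inject₁)
import Data.Fin.Permutation as Permutation
open import Data.Fin.Permutation.Components using (transpose)
import Data.Fin.Properties as FinP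
import Data.Fin.Relation.Unary.Top as Top
open import Data.Integer as ℤ using (ℤ; +_; -[1+_]; 0ℤ; 1ℤ)
open import Data.Integer.DivMod
  using (_%_; _/_; n%d<d; a≡a%n+[a/n]*n; _%ℕ_; _/ℕ_; n%ℕd<d; a≡a%ℕn+[a/ℕn]*n)
import Data.Integer.Properties as ℤP
open import Data.Integer.Tactic.RingSolver using (solve-∀)
open import Data.List using ([]; _∷_; _++_; reverse; foldr; tabulate)
import Data.List.Properties as ListP
open import Data.Nat as ℕ using (zero; suc; z≤n; s≤s; _∸_)
import Data.Nat.Coprimality as Coprimality
import Data.Nat.Induction as ℕInd
import Data.Nat.Properties as ℕP
import Data.Nat.Tactic.RingSolver as ℕ-Ring
open import Data.Product using (_,_; proj₁; proj₂; swap)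
open import Data.Rational as ℚ using (ℚ; mkℚ; 0ℚ; 1ℚ; ↥_; ↧_)
import Data.Rational.Properties as ℚP
open import Data.Rational.Solver using (module +-*-Solver)
open import Function using (_∘_)
open import Induction.WellFounded using (Acc; acc)
open import Relation.Binary.Definitions using (tri<; tri≈; tri>)
open import Relation.Binary.PropositionalEquality
  using (refl; sym; trans; cong; cong₂; subst; subst₂; _≢_; _≗_; module ≡-Reasoning)
open import Relation.Nullary using (¬_; Dec; yes; no)
open import Relation.Nullary.Decidable using (_×-dec_)

open import Algebra.Properties.AbelianGroup ℤP.+-0-abelianGroup
  using () renaming (∙-cancelˡ to +-cancelˡ; ∙-cancelʳ to +-cancelʳ)
open +-*-Solver using (solve; _:+_; _:-_; :-_; _:=_; con)

module ℚΣ = Sum ℚP.+-0-commutativeMonoid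
module ℕΣ = Sum ℕP.+-0-commutativeMonoid

<-suc⇒≤ : ∀ {i j} → i ℤ.< ℤ.suc j → i ℤ.≤ j
<-suc⇒≤ {i} {j} i<1+j = subst (i ℤ.≤_) (ℤP.pred-suc j) (ℤP.i<j⇒i≤pred[j] i<1+j)

<⇒≡+suc : ∀ {u v} → u ℤ.< v → Σ ℕ λ d → v ≡ u ℤ.+ + suc d
<⇒≡+suc {u} {v} u<v with v ℤ.- ℤ.suc u in eq | ℤP.i≤j⇒0≤j-i (ℤP.i<j⇒suc[i]≤j u<v)
... | + d | _ = d , (begin
  v                                  ≡⟨ v≡1+u+[v-[1+u]] u v ⟩
  1ℤ ℤ.+ u ℤ.+ (v ℤ.- (1ℤ ℤ.+ u))     ≡⟨ cong (λ z → 1ℤ ℤ.+ u ℤ.+ z) eq ⟩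
  1ℤ ℤ.+ u ℤ.+ + d                   ≡⟨ 1+u+x≡u+[1+x] u (+ d) ⟩
  u ℤ.+ (1ℤ ℤ.+ + d)                 ∎)
  where
  open ≡-Reasoning
  v≡1+u+[v-[1+u]] : ∀ u v → v ≡ 1ℤ ℤ.+ u ℤ.+ (v ℤ.- (1ℤ ℤ.+ u))
  v≡1+u+[v-[1+u]] = solve-∀
  1+u+x≡u+[1+x] : ∀ u x → 1ℤ ℤ.+ u ℤ.+ x ≡ u ℤ.+ (1ℤ ℤ.+ x)
  1+u+x≡u+[1+x] = solve-∀

x+m≢x : ∀ {m} x → 0 < m → x ℤ.+ + m ≢ x
x+m≢x {m} x 0<m eq = ℕP.<⇒≢ 0<m (sym (ℤP.+-injective (+-cancelˡ x (+ m) 0ℤ (trans eq (sym (ℤP.+-identityʳ x))))))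

+*-<-+* : ∀ {d ρ ρ' Q Q'} → ρ < d → Q ℤ.< Q' → + ρ ℤ.+ Q ℤ.* + d ℤ.< + ρ' ℤ.+ Q' ℤ.* + d
+*-<-+* {d} {ρ} {ρ'} {Q} {Q'} ρ<d Q<Q' = begin-strict
  + ρ ℤ.+ Q ℤ.* + d   <⟨ ℤP.+-monoˡ-< (Q ℤ.* + d) (ℤ.+<+ ρ<d) ⟩
  + d ℤ.+ Q ℤ.* + d   ≡⟨ ℤP.suc-* Q (+ d) ⟨
  ℤ.suc Q ℤ.* + d     ≤⟨ ℤP.*-monoʳ-≤-nonNeg (+ d) (ℤP.i<j⇒suc[i]≤j Q<Q') ⟩
  Q' ℤ.* + d          ≤⟨ ℤP.i≤j+i (Q' ℤ.* + d) (+ ρ') ⟩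
  + ρ' ℤ.+ Q' ℤ.* + d ∎
  where open ℤP.≤-Reasoning

+*-+* : ∀ a q k x → a ℤ.+ q ℤ.* x ℤ.+ k ℤ.* x ≡ a ℤ.+ (q ℤ.+ k) ℤ.* x
+*-+* = solve-∀

divMod-unique : ∀ {d ρ ρ'} Q Q' → ρ < d → ρ' < d →
  + ρ ℤ.+ Q ℤ.* + d ≡ + ρ' ℤ.+ Q' ℤ.* + d → ρ ≡ ρ' × Q ≡ Q'
divMod-unique Q Q' ρ<d ρ'<d eq with ℤP.<-cmp Q Q'
... | tri< Q<Q' _ _ = ⊥-elim (ℤP.<⇒≢ (+*-<-+* ρ<d Q<Q') eq)
... | tri> _ _ Q'<Q = ⊥-elim (ℤP.<⇒≢ (+*-<-+* ρ'<d Q'<Q) (sym eq))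
... | tri≈ _ refl _ = ℤP.+-injective (+-cancelʳ (Q ℤ.* + _) _ _ eq) , refl

ℤtoℚ-mkℚ : ∀ z → ℤtoℚ z ≡ mkℚ z 0 (Coprimality.sym (Coprimality.1-coprimeTo ℤ.∣ z ∣))
ℤtoℚ-mkℚ (+ k)    = ℚP.normalize-coprime {k} {0} _
ℤtoℚ-mkℚ -[1+ k ] = cong ℚ.-_ (ℚP.normalize-coprime {suc k} {0} _)

ℤtoℚ-+ : ∀ a b → ℤtoℚ (a ℤ.+ b) ≡ ℤtoℚ a ℚ.+ ℤtoℚ b
ℤtoℚ-+ a b rewrite ℤtoℚ-mkℚ a | ℤtoℚ-mkℚ b | ℤP.*-identityʳ a | ℤP.*-identityʳ b = refl

ℤtoℚ-neg : ∀ a → ℤtoℚ (ℤ.- a) ≡ ℚ.- ℤtoℚ a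
ℤtoℚ-neg (+ zero)  = refl
ℤtoℚ-neg (+ suc k) = refl
ℤtoℚ-neg -[1+ k ]  rewrite ℤtoℚ-mkℚ (+ suc k) = refl

ℤtoℚ-- : ∀ a b → ℤtoℚ (a ℤ.- b) ≡ ℤtoℚ a ℚ.- ℤtoℚ b
ℤtoℚ-- a b = trans (ℤtoℚ-+ a (ℤ.- b)) (cong (ℤtoℚ a ℚ.+_) (ℤtoℚ-neg b))

ℤtoℚ-mono-≤ : ∀ {a b} → a ℤ.≤ b → ℤtoℚ a ℚ.≤ ℤtoℚ b
ℤtoℚ-mono-≤ {a} {b} a≤b rewrite ℤtoℚ-mkℚ a | ℤtoℚ-mkℚ b =
  ℚ.*≤* (subst₂ ℤ._≤_ (sym (ℤP.*-identityʳ a)) (sym (ℤP.*-identityʳ b)) a≤b)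

ℤtoℚ-cancel-< : ∀ {a b} → ℤtoℚ a ℚ.< ℤtoℚ b → a ℤ.< b
ℤtoℚ-cancel-< {a} {b} a<b rewrite ℤtoℚ-mkℚ a | ℤtoℚ-mkℚ b with a<b
... | ℚ.*<* a*1<b*1 = subst₂ ℤ._<_ (ℤP.*-identityʳ a) (ℤP.*-identityʳ b) a*1<b*1

↥-ℤtoℚ : ∀ z → ↥ ℤtoℚ z ≡ z
↥-ℤtoℚ z rewrite ℤtoℚ-mkℚ z = refl

↧-ℤtoℚ : ∀ z → ↧ ℤtoℚ z ≡ 1ℤ
↧-ℤtoℚ z rewrite ℤtoℚ-mkℚ z = refl

<-by-difference : ∀ {p q r s} → p ℚ.< q → q ℚ.- p ≡ s ℚ.- r → r ℚ.< s
<-by-difference {p} {q} {r} {s} p<q eq = subst₂ ℚ._<_ (ℚP.+-identityʳ r) r+[s-r]≡s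
  (ℚP.+-monoʳ-< r (subst (0ℚ ℚ.<_) eq (subst (ℚ._< q ℚ.- p) (ℚP.+-inverseʳ p) (ℚP.+-monoˡ-< (ℚ.- p) p<q))))
  where
  r+[s-r]≡s : r ℚ.+ (s ℚ.- r) ≡ s
  r+[s-r]≡s = solve 2 (λ r s → r :+ (s :- r) := s) refl r s

≤-by-difference : ∀ {p q r s} → p ℚ.≤ q → q ℚ.- p ≡ s ℚ.- r → r ℚ.≤ s
≤-by-difference {p} {q} {r} {s} p≤q eq = subst₂ ℚ._≤_ (ℚP.+-identityʳ r) r+[s-r]≡s
  (ℚP.+-monoʳ-≤ r (subst (0ℚ ℚ.≤_) eq (subst (ℚ._≤ q ℚ.- p) (ℚP.+-inverseʳ p) (ℚP.+-monoˡ-≤ (ℚ.- p) p≤q))))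
  where
  r+[s-r]≡s : r ℚ.+ (s ℚ.- r) ≡ s
  r+[s-r]≡s = solve 2 (λ r s → r :+ (s :- r) := s) refl r s

≤∧≢⇒< : ∀ {p q} → p ℚ.≤ q → p ≢ q → p ℚ.< q
≤∧≢⇒< {p} {q} p≤q p≢q with ℚP.<-cmp p q
... | tri< p<q _ _ = p<q
... | tri≈ _ p≡q _ = ⊥-elim (p≢q p≡q)
... | tri> _ _ q<p = ⊥-elim (ℚP.<-irrefl refl (ℚP.≤-<-trans p≤q q<p))

≡-neg⇒≡0 : ∀ {p} → p ≡ ℚ.- p → p ≡ 0ℚ
≡-neg⇒≡0 {p} p≡-p with ℚP.<-cmp p 0ℚ
... | tri< p<0 _ _ = ⊥-elim (ℚP.<-asym p<0 (subst (0ℚ ℚ.<_) (sym p≡-p) (ℚP.neg-antimono-< p<0)))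
... | tri≈ _ p≡0 _ = p≡0
... | tri> _ _ 0<p = ⊥-elim (ℚP.<-asym 0<p (subst (ℚ._< 0ℚ) (sym p≡-p) (ℚP.neg-antimono-< 0<p)))

+d≡ℓ⇒≡ℓ-d : ∀ {p d ℓ} → p ℚ.+ ℤtoℚ d ≡ ℤtoℚ ℓ → p ≡ ℤtoℚ (ℓ ℤ.- d)
+d≡ℓ⇒≡ℓ-d {p} {d} {ℓ} eq = begin
  p                                   ≡⟨ solve 2 (λ p d → p := p :+ d :- d) refl p (ℤtoℚ d) ⟩
  p ℚ.+ ℤtoℚ d ℚ.- ℤtoℚ d             ≡⟨ cong (ℚ._- ℤtoℚ d) eq ⟩
  ℤtoℚ ℓ ℚ.- ℤtoℚ d                   ≡⟨ ℤtoℚ-- ℓ d ⟨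
  ℤtoℚ (ℓ ℤ.- d)                      ∎
  where open ≡-Reasoning

+d<ℓ⇒<ℓ-d : ∀ {p d ℓ} → p ℚ.+ ℤtoℚ d ℚ.< ℤtoℚ ℓ → p ℚ.< ℤtoℚ (ℓ ℤ.- d)
+d<ℓ⇒<ℓ-d {p} {d} {ℓ} lt = <-by-difference lt (begin
  ℤtoℚ ℓ ℚ.- (p ℚ.+ ℤtoℚ d)  ≡⟨ solve 3 (λ l p d → l :- (p :+ d) := l :- d :- p) refl (ℤtoℚ ℓ) p (ℤtoℚ d) ⟩
  ℤtoℚ ℓ ℚ.- ℤtoℚ d ℚ.- p    ≡⟨ cong (ℚ._- p) (ℤtoℚ-- ℓ d) ⟨
  ℤtoℚ (ℓ ℤ.- d) ℚ.- p       ∎)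
  where open ≡-Reasoning

<ℓ-d⇒+d<ℓ : ∀ {p d ℓ} → p ℚ.< ℤtoℚ (ℓ ℤ.- d) → p ℚ.+ ℤtoℚ d ℚ.< ℤtoℚ ℓ
<ℓ-d⇒+d<ℓ {p} {d} {ℓ} lt = <-by-difference lt (begin
  ℤtoℚ (ℓ ℤ.- d) ℚ.- p       ≡⟨ cong (ℚ._- p) (ℤtoℚ-- ℓ d) ⟩
  ℤtoℚ ℓ ℚ.- ℤtoℚ d ℚ.- p    ≡⟨ solve 3 (λ l p d → l :- d :- p := l :- (p :+ d)) refl (ℤtoℚ ℓ) p (ℤtoℚ d) ⟩
  ℤtoℚ ℓ ℚ.- (p ℚ.+ ℤtoℚ d)  ∎)
  where open ≡-Reasoning

0<d<ℓ∧d'<1⇒d'<ℓ : ∀ {d d' ℓ} → 0ℚ ℚ.< d → d' ℚ.< 1ℚ → d ℚ.< ℤtoℚ ℓ → d' ℚ.< ℤtoℚ ℓ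
0<d<ℓ∧d'<1⇒d'<ℓ {ℓ = ℓ} 0<d d'<1 d<ℓ = ℚP.<-≤-trans d'<1 (ℤtoℚ-mono-≤ (ℤP.i<j⇒suc[i]≤j 0<ℓ))
  where
  0<ℓ : 0ℤ ℤ.< ℓ
  0<ℓ = ℤtoℚ-cancel-< (ℚP.<-trans 0<d d<ℓ)

floor-≤ : ∀ p → ℤtoℚ (ℚ.floor p) ℚ.≤ p
floor-≤ (mkℚ a d _) = ℚ.*≤* (begin
  ↥ ℤtoℚ f ℤ.* D      ≡⟨ cong (ℤ._* D) (↥-ℤtoℚ f) ⟩
  f ℤ.* D             ≤⟨ ℤP.i≤j+i (f ℤ.* D) (+ (a % D)) ⟩
  + (a % D) ℤ.+ f ℤ.* D ≡⟨ a≡a%n+[a/n]*n a D ⟨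
  a                   ≡⟨ ℤP.*-identityʳ a ⟨
  a ℤ.* 1ℤ            ≡⟨ cong (a ℤ.*_) (↧-ℤtoℚ f) ⟨
  a ℤ.* ↧ ℤtoℚ f      ∎)
  where
  open ℤP.≤-Reasoning
  D = + suc d
  f = a / D

<-suc-floor : ∀ p → p ℚ.< ℤtoℚ (ℤ.suc (ℚ.floor p))
<-suc-floor (mkℚ a d _) = ℚ.*<* (begin-strict
  a ℤ.* ↧ ℤtoℚ (ℤ.suc f) ≡⟨ cong (a ℤ.*_) (↧-ℤtoℚ (ℤ.suc f)) ⟩
  a ℤ.* 1ℤ              ≡⟨ ℤP.*-identityʳ a ⟩
  a                     ≡⟨ a≡a%n+[a/n]*n a D ⟩
  + (a % D) ℤ.+ f ℤ.* D  <⟨ ℤP.+-monoˡ-< (f ℤ.* D) (ℤ.+<+ (n%d<d a D)) ⟩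
  D ℤ.+ f ℤ.* D          ≡⟨ ℤP.suc-* f D ⟨
  ℤ.suc f ℤ.* D          ≡⟨ cong (ℤ._* D) (↥-ℤtoℚ (ℤ.suc f)) ⟨
  ↥ ℤtoℚ (ℤ.suc f) ℤ.* D ∎)
  where
  open ℤP.≤-Reasoning
  D = + suc d
  f = a / D

floor-unique : ∀ {p z} → ℤtoℚ z ℚ.≤ p → p ℚ.< ℤtoℚ (ℤ.suc z) → ℚ.floor p ≡ z
floor-unique {p} {z} z≤p p<1+z = ℤP.≤-antisym
  (<-suc⇒≤ (ℤtoℚ-cancel-< (ℚP.≤-<-trans (floor-≤ p) p<1+z)))
  (<-suc⇒≤ (ℤtoℚ-cancel-< (ℚP.≤-<-trans z≤p (<-suc-floor p))))

floor-1+ : ∀ p → ℚ.floor (1ℚ ℚ.+ p) ≡ ℤ.suc (ℚ.floor p)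
floor-1+ p = floor-unique
  (subst (ℚ._≤ 1ℚ ℚ.+ p) (sym (ℤtoℚ-+ 1ℤ f)) (ℚP.+-monoʳ-≤ 1ℚ (floor-≤ p)))
  (subst (1ℚ ℚ.+ p ℚ.<_) (sym (ℤtoℚ-+ 1ℤ (ℤ.suc f))) (ℚP.+-monoʳ-< 1ℚ (<-suc-floor p)))
  where f = ℚ.floor p

nonNegPart : ℤ → ℕ
nonNegPart (+ k)    = k
nonNegPart -[1+ _ ] = 0

floor⁺ : ℚ → ℕ
floor⁺ p = nonNegPart (ℚ.floor p)

floor⁺-<1 : ∀ {p} → p ℚ.< 1ℚ → floor⁺ p ≡ 0
floor⁺-<1 {p} p<1 with ℚ.floor p | ℤtoℚ-cancel-< {ℚ.floor p} {1ℤ} (ℚP.≤-<-trans (floor-≤ p) p<1)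
... | + zero   | _ = refl
... | + suc _  | ℤ.+<+ (s≤s ())
... | -[1+ _ ] | _ = refl

floor⁺-1+ : ∀ {p} → 0ℚ ℚ.≤ p → floor⁺ (1ℚ ℚ.+ p) ≡ suc (floor⁺ p)
floor⁺-1+ {p} 0≤p = trans (cong nonNegPart (floor-1+ p)) (nonNegPart-suc (ℚ.floor p) 0≤f)
  where
  0≤f : 0ℤ ℤ.≤ ℚ.floor p
  0≤f = <-suc⇒≤ (ℤtoℚ-cancel-< (ℚP.≤-<-trans 0≤p (<-suc-floor p)))
  nonNegPart-suc : ∀ z → 0ℤ ℤ.≤ z → nonNegPart (ℤ.suc z) ≡ suc (nonNegPart z)
  nonNegPart-suc (+ k) _ = refl

foldr-tabulate : ∀ {m} (f : Fin m → ℚ) → foldr ℚ._+_ 0ℚ (tabulate f) ≡ ℚΣ.sum f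
foldr-tabulate {zero}  f = refl
foldr-tabulate {suc m} f = cong (f zero ℚ.+_) (foldr-tabulate (f ∘ suc))

sum-neg : ∀ {m} (f : Fin m → ℚ) → ℚΣ.sum (λ j → ℚ.- f j) ≡ ℚ.- ℚΣ.sum f
sum-neg {zero}  f = refl
sum-neg {suc m} f = trans (cong (ℚ.- f zero ℚ.+_) (sum-neg (f ∘ suc))) (sym (ℚP.neg-distrib-+ (f zero) _))

sum-mono-≤ : ∀ {m} (f g : Fin m → ℕ) → (∀ j → f j ≤ g j) → ℕΣ.sum f ≤ ℕΣ.sum g
sum-mono-≤ {zero}  f g f≤g = z≤n
sum-mono-≤ {suc m} f g f≤g = ℕP.+-mono-≤ (f≤g zero) (sum-mono-≤ (f ∘ suc) (g ∘ suc) (f≤g ∘ suc))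

sum-mono-< : ∀ {m} (f g : Fin m → ℕ) → (∀ j → f j ≤ g j) → ∀ j → f j < g j → ℕΣ.sum f < ℕΣ.sum g
sum-mono-< f g f≤g zero    fj<gj = ℕP.+-mono-<-≤ fj<gj (sum-mono-≤ (f ∘ suc) (g ∘ suc) (f≤g ∘ suc))
sum-mono-< f g f≤g (suc j) fj<gj = ℕP.+-mono-≤-< (f≤g zero) (sum-mono-< (f ∘ suc) (g ∘ suc) (f≤g ∘ suc) j fj<gj)

transpose-matchˡ : ∀ {m} (a b : Fin m) → transpose a b a ≡ b
transpose-matchˡ a b with a Fin.≟ a
... | yes _   = refl
... | no a≢a = ⊥-elim (a≢a refl)

transpose-matchʳ : ∀ {m} (a b : Fin m) → transpose a b b ≡ a
transpose-matchʳ a b with b Fin.≟ a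
... | yes b≡a = b≡a
... | no _ with b Fin.≟ b
...   | yes _   = refl
...   | no b≢b = ⊥-elim (b≢b refl)

transpose-other : ∀ {m} {a b j : Fin m} → j ≢ a → j ≢ b → transpose a b j ≡ j
transpose-other {a = a} {b} {j} j≢a j≢b with j Fin.≟ a
... | yes j≡a = ⊥-elim (j≢a j≡a)
... | no _ with j Fin.≟ b
...   | yes j≡b = ⊥-elim (j≢b j≡b)
...   | no _    = refl

data Place {m} (a b : Fin m) : Fin m → Set where
  at-left   : Place a b a
  at-right  : Place a b b
  elsewhere : ∀ {j} → j ≢ a → j ≢ b → Place a b j

place : ∀ {m} (a b j : Fin m) → Place a b j
place a b j with j Fin.≟ a | j Fin.≟ b
... | yes refl | _        = at-left
... | no _     | yes refl = at-right
... | no j≢a   | no j≢b   = elsewhere j≢a j≢b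

transpose-involutive : ∀ {m} (a b j : Fin m) → transpose a b (transpose a b j) ≡ j
transpose-involutive a b j with place a b j
... | at-left         = trans (cong (transpose a b) (transpose-matchˡ a b)) (transpose-matchʳ a b)
... | at-right        = trans (cong (transpose a b) (transpose-matchʳ a b)) (transpose-matchˡ a b)
... | elsewhere j≢a j≢b = trans (cong (transpose a b) (transpose-other j≢a j≢b)) (transpose-other j≢a j≢b)

at-≡ : ∀ {m} (x : Pt m) {c k} → toℕ c ≡ k → at x k ≡ x c
at-≡ {m} x {c} refl with toℕ c ℕ.<? m
... | yes c<m = cong x (FinP.fromℕ<-toℕ c c<m)
... | no c≮m  = ⊥-elim (c≮m (FinP.toℕ<n c))

Generic⇒≢ : ∀ {n} {x : Pt n} → Generic x → ∀ {j k} → j ≢ k → ∀ ℓ → x j ℚ.- x k ≢ ℤtoℚ ℓ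
Generic⇒≢ {x = x} gx {j} {k} j≢k ℓ eq with FinP.<-cmp j k
... | tri< j<k _ _ = gx j k j<k ℓ eq
... | tri≈ _ j≡k _ = j≢k j≡k
... | tri> _ _ k<j = gx k j k<j (ℤ.- ℓ) (begin
  x k ℚ.- x j        ≡⟨ solve 2 (λ a b → b :- a := :- (a :- b)) refl (x j) (x k) ⟩
  ℚ.- (x j ℚ.- x k)  ≡⟨ cong ℚ.-_ eq ⟩
  ℚ.- ℤtoℚ ℓ         ≡⟨ ℤtoℚ-neg ℓ ⟨
  ℤtoℚ (ℤ.- ℓ)       ∎)
  where open ≡-Reasoning

Generic-cong : ∀ {n} {x y : Pt n} → x ≗ y → Generic x → Generic y
Generic-cong x≗y gx j k j<k ℓ eq = gx j k j<k ℓ (trans (cong₂ ℚ._-_ (x≗y j) (x≗y k)) eq)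

InV-cong : ∀ {n} {x y : Pt n} → x ≗ y → InV x → InV y
InV-cong x≗y xV = trans (cong (foldr ℚ._+_ 0ℚ) (sym (ListP.tabulate-cong x≗y))) xV

SameSide-refl : ∀ {n} {p : Pt n} → SameSide p p
SameSide-refl j k j<k ℓ = (λ h → h) , (λ h → h)

SameSide-sym : ∀ {n} {x y : Pt n} → SameSide x y → SameSide y x
SameSide-sym xy j k j<k ℓ = swap (xy j k j<k ℓ)

SameSide-cong : ∀ {n} {x x' y y' : Pt n} → x ≗ x' → y ≗ y' → SameSide x y → SameSide x' y'
SameSide-cong x≗x' y≗y' xy j k j<k ℓ =
  (λ h → transport y≗y' (proj₁ (xy j k j<k ℓ) (transport (λ i → sym (x≗x' i)) h))) ,
  (λ h → transport x≗x' (proj₂ (xy j k j<k ℓ) (transport (λ i → sym (y≗y' i)) h)))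
  where
  transport : ∀ {u v : Pt _} → u ≗ v → u j ℚ.- u k ℚ.< ℤtoℚ ℓ → v j ℚ.- v k ℚ.< ℤtoℚ ℓ
  transport u≗v = subst (ℚ._< ℤtoℚ ℓ) (cong₂ ℚ._-_ (u≗v j) (u≗v k))

SameSide⇒< : ∀ {n} {x y : Pt n} → Generic y → SameSide x y →
  ∀ j k ℓ → x j ℚ.- x k ℚ.< ℤtoℚ ℓ → y j ℚ.- y k ℚ.< ℤtoℚ ℓ
SameSide⇒< {x = x} {y} gy xy j k ℓ x<ℓ with FinP.<-cmp j k
... | tri< j<k _ _  = proj₁ (xy j k j<k ℓ) x<ℓ
... | tri≈ _ refl _ = subst (ℚ._< ℤtoℚ ℓ) (trans (ℚP.+-inverseʳ (x j)) (sym (ℚP.+-inverseʳ (y j)))) x<ℓ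
... | tri> _ _ k<j with ℚP.<-cmp (y j ℚ.- y k) (ℤtoℚ ℓ)
...   | tri< y<ℓ _ _ = y<ℓ
...   | tri≈ _ y≡ℓ _ = ⊥-elim (Generic⇒≢ {x = y} gy (λ j≡k → FinP.<-irrefl (sym j≡k) k<j) ℓ y≡ℓ)
...   | tri> _ _ ℓ<y = ⊥-elim (ℚP.<-asym x<ℓ (<-by-difference x<-ℓ (flip (x k) (x j))))
  where
  flip : ∀ a b → ℚ.- ℤtoℚ ℓ ℚ.- (a ℚ.- b) ≡ b ℚ.- a ℚ.- ℤtoℚ ℓ
  flip a b = solve 3 (λ l a b → :- l :- (a :- b) := b :- a :- l) refl (ℤtoℚ ℓ) a b
  y<-ℓ : y k ℚ.- y j ℚ.< ℚ.- ℤtoℚ ℓ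
  y<-ℓ = <-by-difference ℓ<y (solve 3 (λ l a b → a :- b :- l := :- l :- (b :- a)) refl (ℤtoℚ ℓ) (y j) (y k))
  x<-ℓ : x k ℚ.- x j ℚ.< ℚ.- ℤtoℚ ℓ
  x<-ℓ = subst (x k ℚ.- x j ℚ.<_) (ℤtoℚ-neg ℓ)
           (proj₂ (xy k j k<j (ℤ.- ℓ)) (subst (y k ℚ.- y j ℚ.<_) (sym (ℤtoℚ-neg ℓ)) y<-ℓ))

module _ {N : ℕ} where

  -- Positions: the integer c + 1 + q n carries coordinate c of window q

  private
    n : ℕ
    n = suc (suc N)

  pos : Fin n → ℤ → ℤ
  pos c q = + suc (toℕ c) ℤ.+ q ℤ.* + n

  pos-injective : ∀ {c c' q q'} → pos c q ≡ pos c' q' → c ≡ c' × q ≡ q'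
  pos-injective {c} {c'} {q} {q'} eq
    with divMod-unique q q' (FinP.toℕ<n c) (FinP.toℕ<n c') (+-cancelˡ 1ℤ (+ toℕ c ℤ.+ q ℤ.* + n) _
           (trans (sym (ℤP.+-assoc 1ℤ (+ toℕ c) (q ℤ.* + n))) (trans eq (ℤP.+-assoc 1ℤ (+ toℕ c') (q' ℤ.* + n)))))
  ... | c≡c' , q≡q' = FinP.toℕ-injective c≡c' , q≡q'

  pos-+* : ∀ c q k → pos c q ℤ.+ k ℤ.* + n ≡ pos c (q ℤ.+ k)
  pos-+* c q k = +*-+* (+ suc (toℕ c)) q k (+ n)

  window : ℤ → Fin n × ℤ
  window u = fromℕ< (n%ℕd<d (u ℤ.- 1ℤ) n) , (u ℤ.- 1ℤ) /ℕ n

  pos-window : ∀ u → pos (proj₁ (window u)) (proj₂ (window u)) ≡ u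
  pos-window u = begin
    + suc (toℕ (fromℕ< _)) ℤ.+ Q ℤ.* + n   ≡⟨ cong (λ ρ → + suc ρ ℤ.+ Q ℤ.* + n) (FinP.toℕ-fromℕ< (n%ℕd<d v n)) ⟩
    1ℤ ℤ.+ + (v %ℕ n) ℤ.+ Q ℤ.* + n        ≡⟨ ℤP.+-assoc 1ℤ (+ (v %ℕ n)) (Q ℤ.* + n) ⟩
    1ℤ ℤ.+ (+ (v %ℕ n) ℤ.+ Q ℤ.* + n)      ≡⟨ cong (λ z → 1ℤ ℤ.+ z) (a≡a%ℕn+[a/ℕn]*n v n) ⟨
    1ℤ ℤ.+ (u ℤ.- 1ℤ)                      ≡⟨ 1+[u-1]≡u u ⟩
    u                                      ∎
    where
    open ≡-Reasoning
    v = u ℤ.- 1ℤ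
    Q = v /ℕ n
    1+[u-1]≡u : ∀ u → 1ℤ ℤ.+ (u ℤ.- 1ℤ) ≡ u
    1+[u-1]≡u = solve-∀

  window-pos : ∀ c q → window (pos c q) ≡ (c , q)
  window-pos c q with pos-injective (pos-window (pos c q))
  ... | c'≡c , q'≡q = cong₂ _,_ c'≡c q'≡q

  data Positioned : ℤ → Set where
    position : ∀ c q → Positioned (pos c q)

  positioned : ∀ u → Positioned u
  positioned u = subst Positioned (pos-window u) (position (proj₁ (window u)) (proj₂ (window u)))

  res-+* : ∀ {ρ} Q → ρ < n → res n (+ ρ ℤ.+ Q ℤ.* + n) ≡ ρ
  res-+* {ρ} Q ρ<n = proj₁ (divMod-unique (x /ℕ n) Q (n%ℕd<d x n) ρ<n (sym (a≡a%ℕn+[a/ℕn]*n x n)))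
    where x = + ρ ℤ.+ Q ℤ.* + n

  res-periodic : ∀ z k → res n (z ℤ.+ k ℤ.* + n) ≡ res n z
  res-periodic z k = begin
    res n (z ℤ.+ k ℤ.* + n)                   ≡⟨ cong (λ z → res n (z ℤ.+ k ℤ.* + n)) (a≡a%ℕn+[a/ℕn]*n z n) ⟩
    res n (+ ρ ℤ.+ Q ℤ.* + n ℤ.+ k ℤ.* + n)   ≡⟨ cong (res n) (+*-+* (+ ρ) Q k (+ n)) ⟩
    res n (+ ρ ℤ.+ (Q ℤ.+ k) ℤ.* + n)         ≡⟨ res-+* (Q ℤ.+ k) (n%ℕd<d z n) ⟩
    ρ                                         ∎
    where
    open ≡-Reasoning
    ρ = z %ℕ n
    Q = z /ℕ n

  res-≡⇒≡+* : ∀ u v → res n u ≡ res n v → u ≡ v ℤ.+ (u /ℕ n ℤ.- v /ℕ n) ℤ.* + n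
  res-≡⇒≡+* u v eq = begin
    u                                               ≡⟨ a≡a%ℕn+[a/ℕn]*n u n ⟩
    + (u %ℕ n) ℤ.+ u /ℕ n ℤ.* + n                   ≡⟨ cong (λ ρ → + ρ ℤ.+ u /ℕ n ℤ.* + n) eq ⟩
    + (v %ℕ n) ℤ.+ u /ℕ n ℤ.* + n                   ≡⟨ a+px≡a+qx+[p-q]x (+ (v %ℕ n)) (u /ℕ n) (v /ℕ n) (+ n) ⟩
    + (v %ℕ n) ℤ.+ v /ℕ n ℤ.* + n ℤ.+ k ℤ.* + n     ≡⟨ cong (ℤ._+ k ℤ.* + n) (a≡a%ℕn+[a/ℕn]*n v n) ⟨
    v ℤ.+ k ℤ.* + n                                 ∎
    where
    open ≡-Reasoning
    k = u /ℕ n ℤ.- v /ℕ n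
    a+px≡a+qx+[p-q]x : ∀ a p q x → a ℤ.+ p ℤ.* x ≡ a ℤ.+ q ℤ.* x ℤ.+ (p ℤ.- q) ℤ.* x
    a+px≡a+qx+[p-q]x = solve-∀

  res-pos-injective : ∀ c q c' q' → res n (pos c q) ≡ res n (pos c' q') → c ≡ c'
  res-pos-injective c q c' q' eq =
    proj₁ (pos-injective {q = q} {q' ℤ.+ k} (trans (res-≡⇒≡+* (pos c q) (pos c' q') eq) (pos-+* c' q' k)))
    where k = pos c q /ℕ n ℤ.- pos c' q' /ℕ n

  -- The generators: s i exchanges coordinates prev i and i, shifted by ± wrap i (nonzero only for s₀)

  last : Fin n
  last = Fin.fromℕ (suc N)

  prev : Fin n → Fin n
  prev zero    = last
  prev (suc t) = inject₁ t

  wrap : Fin n → ℤ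
  wrap zero    = 1ℤ
  wrap (suc _) = 0ℤ

  prev≢ : ∀ i → prev i ≢ i
  prev≢ zero    ()
  prev≢ (suc t) eq = ℕP.1+n≢n (sym (trans (sym (FinP.toℕ-inject₁ t)) (cong toℕ eq)))

  pos-prev : ∀ i q → pos (prev i) q ≡ + toℕ i ℤ.+ (q ℤ.+ wrap i) ℤ.* + n
  pos-prev zero q = begin
    + suc (toℕ last) ℤ.+ q ℤ.* + n ≡⟨ cong (λ t → + suc t ℤ.+ q ℤ.* + n) (FinP.toℕ-fromℕ (suc N)) ⟩
    + n ℤ.+ q ℤ.* + n              ≡⟨ x+qx≡0+[q+1]x (+ n) q ⟩
    0ℤ ℤ.+ (q ℤ.+ 1ℤ) ℤ.* + n      ∎
    where
    open ≡-Reasoning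
    x+qx≡0+[q+1]x : ∀ x q → x ℤ.+ q ℤ.* x ≡ 0ℤ ℤ.+ (q ℤ.+ 1ℤ) ℤ.* x
    x+qx≡0+[q+1]x = solve-∀
  pos-prev (suc t) q =
    cong₂ (λ a b → + suc a ℤ.+ b ℤ.* + n) (FinP.toℕ-inject₁ t) (sym (ℤP.+-identityʳ q))

  res-pos-prev : ∀ i q → res n (pos (prev i) q) ≡ toℕ i
  res-pos-prev i q = trans (cong (res n) (pos-prev i q)) (res-+* (q ℤ.+ wrap i) (FinP.toℕ<n i))

  pos-prev-+1 : ∀ i q → pos (prev i) q ℤ.+ 1ℤ ≡ pos i (q ℤ.+ wrap i)
  pos-prev-+1 i q = trans (cong (ℤ._+ 1ℤ) (pos-prev i q)) (a+px+1≡1+a+px (+ toℕ i) (q ℤ.+ wrap i) (+ n))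
    where
    a+px+1≡1+a+px : ∀ a p x → a ℤ.+ p ℤ.* x ℤ.+ 1ℤ ≡ 1ℤ ℤ.+ a ℤ.+ p ℤ.* x
    a+px+1≡1+a+px = solve-∀

  σ : Fin n → Fin n → Fin n
  σ i = transpose (prev i) i

  shift : Fin n → Fin n → ℤ
  shift i j with j Fin.≟ prev i | j Fin.≟ i
  ... | yes _ | _     = wrap i
  ... | no _  | yes _ = ℤ.- wrap i
  ... | no _  | no _  = 0ℤ

  shift-prev : ∀ i → shift i (prev i) ≡ wrap i
  shift-prev i with prev i Fin.≟ prev i
  ... | yes _ = refl
  ... | no ≢  = ⊥-elim (≢ refl)

  shift-self : ∀ i → shift i i ≡ ℤ.- wrap i
  shift-self i with i Fin.≟ prev i
  ... | yes i≡p = ⊥-elim (prev≢ i (sym i≡p))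
  ... | no _ with i Fin.≟ i
  ...   | yes _ = refl
  ...   | no ≢  = ⊥-elim (≢ refl)

  shift-other : ∀ {i j} → j ≢ prev i → j ≢ i → shift i j ≡ 0ℤ
  shift-other {i} {j} j≢p j≢i with j Fin.≟ prev i
  ... | yes j≡p = ⊥-elim (j≢p j≡p)
  ... | no _ with j Fin.≟ i
  ...   | yes j≡i = ⊥-elim (j≢i j≡i)
  ...   | no _    = refl

  sZ-pos-prev : ∀ i q → sZ n i (pos (prev i) q) ≡ pos i (q ℤ.+ wrap i)
  sZ-pos-prev i q with res n (pos (prev i) q) ℕ.≟ toℕ i
  ... | yes _ = pos-prev-+1 i q
  ... | no ≢  = ⊥-elim (≢ (res-pos-prev i q))

  sZ-pos-self : ∀ i q → sZ n i (pos i q) ≡ pos (prev i) (q ℤ.- wrap i)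
  sZ-pos-self i q with res n (pos i q) ℕ.≟ toℕ i
  ... | yes eq = ⊥-elim (prev≢ i (sym (res-pos-injective i q (prev i) 0ℤ (trans eq (sym (res-pos-prev i 0ℤ))))))
  ... | no _ with res n (pos i q) ℕ.≟ res n (+ suc (toℕ i))
  ...   | no ≢  = ⊥-elim (≢ (res-periodic (+ suc (toℕ i)) q))
  ...   | yes _ = begin
    pos i q ℤ.- 1ℤ                              ≡⟨ cong (λ q → pos i q ℤ.- 1ℤ) (q≡q-w+w q (wrap i)) ⟩
    pos i (q ℤ.- wrap i ℤ.+ wrap i) ℤ.- 1ℤ      ≡⟨ cong (ℤ._- 1ℤ) (pos-prev-+1 i (q ℤ.- wrap i)) ⟨
    pos (prev i) (q ℤ.- wrap i) ℤ.+ 1ℤ ℤ.- 1ℤ   ≡⟨ a+1-1≡a (pos (prev i) (q ℤ.- wrap i)) ⟩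
    pos (prev i) (q ℤ.- wrap i)                 ∎
    where
    open ≡-Reasoning
    q≡q-w+w : ∀ q w → q ≡ q ℤ.- w ℤ.+ w
    q≡q-w+w = solve-∀
    a+1-1≡a : ∀ a → a ℤ.+ 1ℤ ℤ.- 1ℤ ≡ a
    a+1-1≡a = solve-∀

  sZ-pos-other : ∀ {i c} q → c ≢ prev i → c ≢ i → sZ n i (pos c q) ≡ pos c q
  sZ-pos-other {i} {c} q c≢p c≢i with res n (pos c q) ℕ.≟ toℕ i
  ... | yes eq = ⊥-elim (c≢p (res-pos-injective c q (prev i) 0ℤ (trans eq (sym (res-pos-prev i 0ℤ)))))
  ... | no _ with res n (pos c q) ℕ.≟ res n (+ suc (toℕ i))
  ...   | yes eq = ⊥-elim (c≢i (res-pos-injective c q i 0ℤ (trans eq (sym (res-periodic (+ suc (toℕ i)) 0ℤ)))))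
  ...   | no _   = refl

  sZ-pos : ∀ i c q → sZ n i (pos c q) ≡ pos (σ i c) (q ℤ.+ shift i c)
  sZ-pos i c q with place (prev i) i c
  ... | at-left  rewrite transpose-matchˡ (prev i) i | shift-prev i = sZ-pos-prev i q
  ... | at-right rewrite transpose-matchʳ (prev i) i | shift-self i = sZ-pos-self i q
  ... | elsewhere c≢p c≢i rewrite transpose-other c≢p c≢i | shift-other c≢p c≢i | ℤP.+-identityʳ q =
    sZ-pos-other q c≢p c≢i

  sAct-self : ∀ i x → sAct n i x i ≡ x (prev i) ℚ.+ ℤtoℚ (wrap i)
  sAct-self zero x = cong (ℚ._+ 1ℚ) (at-≡ x (FinP.toℕ-fromℕ (suc N)))
  sAct-self (suc t) x with suc (toℕ t) ℕ.≟ toℕ t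
  ... | yes eq = ⊥-elim (ℕP.1+n≢n eq)
  ... | no _ with suc (toℕ t) ℕ.≟ suc (toℕ t)
  ...   | yes _ = trans (at-≡ x (FinP.toℕ-inject₁ t)) (sym (ℚP.+-identityʳ _))
  ...   | no ≢  = ⊥-elim (≢ refl)

  sAct-prev : ∀ i x → sAct n i x (prev i) ≡ x i ℚ.- ℤtoℚ (wrap i)
  sAct-prev zero x with toℕ last ℕ.≟ suc N
  ... | yes _ = refl
  ... | no ≢  = ⊥-elim (≢ (FinP.toℕ-fromℕ (suc N)))
  sAct-prev (suc t) x with toℕ (inject₁ t) ℕ.≟ toℕ t
  ... | yes _ = trans (at-≡ x refl) (sym (ℚP.+-identityʳ _))
  ... | no ≢  = ⊥-elim (≢ (FinP.toℕ-inject₁ t))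

  sAct-other : ∀ i x {j} → j ≢ prev i → j ≢ i → sAct n i x j ≡ x j
  sAct-other zero x {j} j≢p j≢i with toℕ j ℕ.≟ 0
  ... | yes eq = ⊥-elim (j≢i (FinP.toℕ-injective eq))
  ... | no _ with toℕ j ℕ.≟ suc N
  ...   | yes eq = ⊥-elim (j≢p (FinP.toℕ-injective (trans eq (sym (FinP.toℕ-fromℕ (suc N))))))
  ...   | no _   = refl
  sAct-other (suc t) x {j} j≢p j≢i with toℕ j ℕ.≟ toℕ t
  ... | yes eq = ⊥-elim (j≢p (FinP.toℕ-injective (trans eq (sym (FinP.toℕ-inject₁ t)))))
  ... | no _ with toℕ j ℕ.≟ suc (toℕ t)
  ...   | yes eq = ⊥-elim (j≢i (FinP.toℕ-injective eq))
  ...   | no _   = refl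

  sAct-σ : ∀ i x j → sAct n i x (σ i j) ≡ x j ℚ.+ ℤtoℚ (shift i j)
  sAct-σ i x j with place (prev i) i j
  ... | at-left  rewrite transpose-matchˡ (prev i) i | shift-prev i = sAct-self i x
  ... | at-right rewrite transpose-matchʳ (prev i) i | shift-self i =
    trans (sAct-prev i x) (cong (x i ℚ.+_) (sym (ℤtoℚ-neg (wrap i))))
  ... | elsewhere j≢p j≢i rewrite transpose-other j≢p j≢i | shift-other j≢p j≢i =
    trans (sAct-other i x j≢p j≢i) (sym (ℚP.+-identityʳ (x j)))

  σ-involutive : ∀ i j → σ i (σ i j) ≡ j
  σ-involutive i = transpose-involutive (prev i) i

  σ-injective : ∀ i {j k} → σ i j ≡ σ i k → j ≡ k
  σ-injective i {j} {k} eq = trans (sym (σ-involutive i j)) (trans (cong (σ i) eq) (σ-involutive i k))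

  sAct-affine : ∀ i x j → sAct n i x j ≡ x (σ i j) ℚ.+ ℤtoℚ (shift i (σ i j))
  sAct-affine i x j = trans (cong (sAct n i x) (sym (σ-involutive i j))) (sAct-σ i x (σ i j))

  shift-σ : ∀ i j → shift i (σ i j) ≡ ℤ.- shift i j
  shift-σ i j with place (prev i) i j
  ... | at-left  rewrite transpose-matchˡ (prev i) i | shift-prev i | shift-self i = refl
  ... | at-right rewrite transpose-matchʳ (prev i) i | shift-prev i | shift-self i =
    sym (ℤP.neg-involutive (wrap i))
  ... | elsewhere j≢p j≢i rewrite transpose-other j≢p j≢i | shift-other j≢p j≢i = refl

  sZ-involutive : ∀ i u → sZ n i (sZ n i u) ≡ u
  sZ-involutive i u with positioned u
  ... | position c q = begin
    sZ n i (sZ n i (pos c q))                                ≡⟨ cong (sZ n i) (sZ-pos i c q) ⟩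
    sZ n i (pos (σ i c) (q ℤ.+ shift i c))                   ≡⟨ sZ-pos i (σ i c) (q ℤ.+ shift i c) ⟩
    pos (σ i (σ i c)) (q ℤ.+ shift i c ℤ.+ shift i (σ i c))  ≡⟨ cong₂ pos (σ-involutive i c) q+s-s≡q ⟩
    pos c q                                                  ∎
    where
    open ≡-Reasoning
    q+s+[-s]≡q : ∀ q s → q ℤ.+ s ℤ.+ ℤ.- s ≡ q
    q+s+[-s]≡q = solve-∀
    q+s-s≡q : q ℤ.+ shift i c ℤ.+ shift i (σ i c) ≡ q
    q+s-s≡q = trans (cong (λ s → q ℤ.+ shift i c ℤ.+ s) (shift-σ i c)) (q+s+[-s]≡q q (shift i c))

  sAct-involutive : ∀ i x → sAct n i (sAct n i x) ≗ x
  sAct-involutive i x j = begin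
    sAct n i (sAct n i x) j                        ≡⟨ sAct-affine i (sAct n i x) j ⟩
    sAct n i x (σ i j) ℚ.+ ℤtoℚ (shift i (σ i j))  ≡⟨ cong₂ ℚ._+_ (sAct-σ i x j) (cong ℤtoℚ (shift-σ i j)) ⟩
    x j ℚ.+ S ℚ.+ ℤtoℚ (ℤ.- shift i j)             ≡⟨ cong (x j ℚ.+ S ℚ.+_) (ℤtoℚ-neg (shift i j)) ⟩
    x j ℚ.+ S ℚ.+ ℚ.- S                            ≡⟨ solve 2 (λ a s → a :+ s :+ :- s := a) refl (x j) S ⟩
    x j                                            ∎
    where
    open ≡-Reasoning
    S = ℤtoℚ (shift i j)

  -- The sequence of a point

  ext : Pt n → ℤ → ℚ
  ext y u = y (proj₁ (window u)) ℚ.- ℤtoℚ (proj₂ (window u))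

  ext-pos : ∀ y c q → ext y (pos c q) ≡ y c ℚ.- ℤtoℚ q
  ext-pos y c q = cong (λ (c , q) → y c ℚ.- ℤtoℚ q) (window-pos c q)

  ext-cong : ∀ {x y : Pt n} → x ≗ y → ext x ≗ ext y
  ext-cong x≗y u = cong (ℚ._- ℤtoℚ (proj₂ (window u))) (x≗y (proj₁ (window u)))

  ext-sZ : ∀ i y u → ext (sAct n i y) (sZ n i u) ≡ ext y u
  ext-sZ i y u with positioned u
  ... | position c q = begin
    ext (sAct n i y) (sZ n i (pos c q))               ≡⟨ cong (ext (sAct n i y)) (sZ-pos i c q) ⟩
    ext (sAct n i y) (pos (σ i c) (q ℤ.+ shift i c))  ≡⟨ ext-pos (sAct n i y) (σ i c) (q ℤ.+ shift i c) ⟩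
    sAct n i y (σ i c) ℚ.- ℤtoℚ (q ℤ.+ shift i c)     ≡⟨ cong₂ ℚ._-_ (sAct-σ i y c) (ℤtoℚ-+ q (shift i c)) ⟩
    y c ℚ.+ S ℚ.- (Q ℚ.+ S)                           ≡⟨ solve 3 (λ a s q → a :+ s :- (q :+ s) := a :- q) refl (y c) S Q ⟩
    y c ℚ.- Q                                         ≡⟨ ext-pos y c q ⟨
    ext y (pos c q)                                   ∎
    where
    open ≡-Reasoning
    S = ℤtoℚ (shift i c)
    Q = ℤtoℚ q

  act-++ : ∀ xs ys x → act n (xs ++ ys) x ≡ act n xs (act n ys x)
  act-++ xs ys x = ListP.foldr-++ (sAct n) x xs ys

  perm-++ : ∀ xs ys u → perm n (xs ++ ys) u ≡ perm n xs (perm n ys u)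
  perm-++ []       ys u = refl
  perm-++ (i ∷ xs) ys u = cong (sZ n i) (perm-++ xs ys u)

  sAct-cong : ∀ i {x y} → x ≗ y → sAct n i x ≗ sAct n i y
  sAct-cong i {x} {y} x≗y j =
    trans (sAct-affine i x j) (trans (cong (ℚ._+ _) (x≗y (σ i j))) (sym (sAct-affine i y j)))

  act-cong : ∀ w {x y} → x ≗ y → act n w x ≗ act n w y
  act-cong []      x≗y = x≗y
  act-cong (i ∷ w) x≗y = sAct-cong i (act-cong w x≗y)

  act-reverse : ∀ w x → act n (reverse w) (act n w x) ≗ x
  act-reverse []      x j = refl
  act-reverse (i ∷ w) x j = begin
    act n (reverse (i ∷ w)) (act n (i ∷ w) x) j              ≡⟨ cong (λ v → act n v (act n (i ∷ w) x) j) (ListP.unfold-reverse i w) ⟩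
    act n (reverse w ++ i ∷ []) (sAct n i (act n w x)) j     ≡⟨ cong (λ z → z j) (act-++ (reverse w) (i ∷ []) (sAct n i (act n w x))) ⟩
    act n (reverse w) (sAct n i (sAct n i (act n w x))) j    ≡⟨ act-cong (reverse w) (sAct-involutive i (act n w x)) j ⟩
    act n (reverse w) (act n w x) j                          ≡⟨ act-reverse w x j ⟩
    x j                                                      ∎
    where open ≡-Reasoning

  perm-reverse : ∀ w u → perm n w (perm n (reverse w) u) ≡ u
  perm-reverse []      u = refl
  perm-reverse (i ∷ w) u = begin
    sZ n i (perm n w (perm n (reverse (i ∷ w)) u))          ≡⟨ cong (λ v → sZ n i (perm n w (perm n v u))) (ListP.unfold-reverse i w) ⟩
    sZ n i (perm n w (perm n (reverse w ++ i ∷ []) u))      ≡⟨ cong (λ z → sZ n i (perm n w z)) (perm-++ (reverse w) (i ∷ []) u) ⟩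
    sZ n i (perm n w (perm n (reverse w) (sZ n i u)))       ≡⟨ cong (sZ n i) (perm-reverse w (sZ n i u)) ⟩
    sZ n i (sZ n i u)                                       ≡⟨ sZ-involutive i u ⟩
    u                                                       ∎
    where open ≡-Reasoning

  ext-act : ∀ w y u → ext (act n w y) (perm n w u) ≡ ext y u
  ext-act []      y u = refl
  ext-act (i ∷ w) y u = trans (ext-sZ i (act n w y) (perm n w u)) (ext-act w y u)

  sum-shift : ∀ i → ℚΣ.sum (ℤtoℚ ∘ shift i) ≡ 0ℚ
  sum-shift i = ≡-neg⇒≡0 (begin
    ℚΣ.sum (ℤtoℚ ∘ shift i)                  ≡⟨ ℚΣ.sum-permute (ℤtoℚ ∘ shift i) (Permutation.transpose (prev i) i) ⟩
    ℚΣ.sum (λ j → ℤtoℚ (shift i (σ i j)))    ≡⟨ ℚΣ.sum-cong-≗ (λ j → trans (cong ℤtoℚ (shift-σ i j)) (ℤtoℚ-neg (shift i j))) ⟩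
    ℚΣ.sum (λ j → ℚ.- ℤtoℚ (shift i j))      ≡⟨ sum-neg (ℤtoℚ ∘ shift i) ⟩
    ℚ.- ℚΣ.sum (ℤtoℚ ∘ shift i)              ∎)
    where open ≡-Reasoning

  InV-sAct : ∀ i {x} → InV x → InV (sAct n i x)
  InV-sAct i {x} xV = begin
    foldr ℚ._+_ 0ℚ (tabulate (sAct n i x))            ≡⟨ foldr-tabulate (sAct n i x) ⟩
    ℚΣ.sum (sAct n i x)                               ≡⟨ ℚΣ.sum-permute (sAct n i x) (Permutation.transpose (prev i) i) ⟩
    ℚΣ.sum (λ j → sAct n i x (σ i j))                 ≡⟨ ℚΣ.sum-cong-≗ (sAct-σ i x) ⟩
    ℚΣ.sum (λ j → x j ℚ.+ ℤtoℚ (shift i j))           ≡⟨ ℚΣ.∑-distrib-+ x (ℤtoℚ ∘ shift i) ⟩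
    ℚΣ.sum x ℚ.+ ℚΣ.sum (ℤtoℚ ∘ shift i)              ≡⟨ cong₂ ℚ._+_ (trans (sym (foldr-tabulate x)) xV) (sum-shift i) ⟩
    0ℚ                                                ∎
    where open ≡-Reasoning

  sAct-diff : ∀ i x j k → sAct n i x j ℚ.- sAct n i x k ≡
    x (σ i j) ℚ.- x (σ i k) ℚ.+ ℤtoℚ (shift i (σ i j) ℤ.- shift i (σ i k))
  sAct-diff i x j k = begin
    sAct n i x j ℚ.- sAct n i x k           ≡⟨ cong₂ ℚ._-_ (sAct-affine i x j) (sAct-affine i x k) ⟩
    a ℚ.+ ℤtoℚ s ℚ.- (b ℚ.+ ℤtoℚ t)         ≡⟨ solve 4 (λ a b s t → a :+ s :- (b :+ t) := a :- b :+ (s :- t)) refl a b (ℤtoℚ s) (ℤtoℚ t) ⟩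
    a ℚ.- b ℚ.+ (ℤtoℚ s ℚ.- ℤtoℚ t)         ≡⟨ cong (a ℚ.- b ℚ.+_) (ℤtoℚ-- s t) ⟨
    a ℚ.- b ℚ.+ ℤtoℚ (s ℤ.- t)              ∎
    where
    open ≡-Reasoning
    a = x (σ i j)
    b = x (σ i k)
    s = shift i (σ i j)
    t = shift i (σ i k)

  Generic-sAct : ∀ i {x} → Generic x → Generic (sAct n i x)
  Generic-sAct i {x} gx j k j<k ℓ eq =
    Generic⇒≢ {x = x} gx (λ σj≡σk → FinP.<-irrefl (σ-injective i σj≡σk) j<k) (ℓ ℤ.- δ)
      (+d≡ℓ⇒≡ℓ-d {d = δ} {ℓ} (trans (sym (sAct-diff i x j k)) eq))
    where δ = shift i (σ i j) ℤ.- shift i (σ i k)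

  SameSide-sAct : ∀ i {x y} → Generic x → Generic y → SameSide x y → SameSide (sAct n i x) (sAct n i y)
  SameSide-sAct i {x} {y} gx gy xy j k j<k ℓ = transfer {x} {y} gy xy , transfer {y} {x} gx (SameSide-sym {x = x} {y} xy)
    where
    δ = shift i (σ i j) ℤ.- shift i (σ i k)
    transfer : ∀ {x y} → Generic y → SameSide x y →
      sAct n i x j ℚ.- sAct n i x k ℚ.< ℤtoℚ ℓ → sAct n i y j ℚ.- sAct n i y k ℚ.< ℤtoℚ ℓ
    transfer {x} {y} gy xy x<ℓ = subst (ℚ._< ℤtoℚ ℓ) (sym (sAct-diff i y j k))
      (<ℓ-d⇒+d<ℓ {d = δ} {ℓ} (SameSide⇒< {x = x} {y} gy xy (σ i j) (σ i k) (ℓ ℤ.- δ)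
        (+d<ℓ⇒<ℓ-d {d = δ} {ℓ} (subst (ℚ._< ℤtoℚ ℓ) (sAct-diff i x j k) x<ℓ))))

  InV-act : ∀ w {x} → InV x → InV (act n w x)
  InV-act []      xV = xV
  InV-act (i ∷ w) xV = InV-sAct i (InV-act w xV)

  Generic-act : ∀ w {x} → Generic x → Generic (act n w x)
  Generic-act []      gx = gx
  Generic-act (i ∷ w) gx = Generic-sAct i (Generic-act w gx)

  SameSide-act : ∀ w {x y} → Generic x → Generic y → SameSide x y → SameSide (act n w x) (act n w y)
  SameSide-act []      gx gy xy = xy
  SameSide-act (i ∷ w) gx gy xy =
    SameSide-sAct i (Generic-act w gx) (Generic-act w gy) (SameSide-act w gx gy xy)

  -- The fundamental alcove

  Descending : Pt n → Set
  Descending a = ∀ i → a i ℚ.- a (prev i) ℚ.< ℤtoℚ (wrap i)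

  InA0⇒Descending : ∀ {a} → InA0 n a → Descending a
  InA0⇒Descending {a} (_ , _ , a₀-1<aₙ) zero = <-by-difference a₀-1<a-last
    (solve 2 (λ a₀ aₗ → aₗ :- (a₀ :- con 1ℚ) := con 1ℚ :- (a₀ :- aₗ)) refl (a zero) (a last))
    where
    a₀-1<a-last : a zero ℚ.- 1ℚ ℚ.< a last
    a₀-1<a-last = subst₂ ℚ._<_ (cong (ℚ._- 1ℚ) (at-≡ a refl)) (at-≡ a (FinP.toℕ-fromℕ (suc N))) a₀-1<aₙ
  InA0⇒Descending {a} (_ , a-dec , _) (suc t) = <-by-difference (a-dec (inject₁ t) (suc t) (cong suc (sym (FinP.toℕ-inject₁ t))))
    (solve 2 (λ p s → p :- s := con 0ℚ :- (s :- p)) refl (a (inject₁ t)) (a (suc t)))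

  Descending⇒InA0 : ∀ {a} → InV a → Descending a → InA0 n a
  Descending⇒InA0 {a} aV desc = aV , a-dec , a₀-1<aₙ
    where
    a-dec : ∀ i j → toℕ j ≡ suc (toℕ i) → a j ℚ.< a i
    a-dec i (suc t) eq = subst (λ i → a (suc t) ℚ.< a i) t≡i (<-by-difference (desc (suc t))
      (solve 2 (λ p s → con 0ℚ :- (s :- p) := p :- s) refl (a (inject₁ t)) (a (suc t))))
      where
      t≡i : inject₁ t ≡ i
      t≡i = FinP.toℕ-injective (trans (FinP.toℕ-inject₁ t) (ℕP.suc-injective eq))
    a₀-1<aₙ : at a 0 ℚ.- 1ℚ ℚ.< at a (n ∸ 1)
    a₀-1<aₙ = subst₂ ℚ._<_ (cong (ℚ._- 1ℚ) (sym (at-≡ a refl))) (sym (at-≡ a (FinP.toℕ-fromℕ (suc N))))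
      (<-by-difference (desc zero)
        (solve 2 (λ a₀ aₗ → con 1ℚ :- (a₀ :- aₗ) := aₗ :- (a₀ :- con 1ℚ)) refl (a zero) (a last)))

  data Prev : Fin n → Set where
    prev-of : ∀ i → Prev (prev i)

  prev-view : ∀ c → Prev c
  prev-view c with Top.view c
  ... | Top.‵fromℕ     = prev-of zero
  ... | Top.‵inject₁ t = prev-of (suc t)

  ext-+1-< : ∀ {a} → Descending a → ∀ u → ext a (u ℤ.+ 1ℤ) ℚ.< ext a u
  ext-+1-< {a} desc u with positioned u
  ... | position c q with prev-view c
  ...   | prev-of i = subst₂ ℚ._<_ (sym ext-next) (sym (ext-pos a (prev i) q))
    (<-by-difference (desc i) (solve 4 (λ aᵢ aₚ Q W → W :- (aᵢ :- aₚ) := aₚ :- Q :- (aᵢ :- (Q :+ W))) refl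
      (a i) (a (prev i)) (ℤtoℚ q) (ℤtoℚ (wrap i))))
    where
    ext-next : ext a (pos (prev i) q ℤ.+ 1ℤ) ≡ a i ℚ.- (ℤtoℚ q ℚ.+ ℤtoℚ (wrap i))
    ext-next = trans (cong (ext a) (pos-prev-+1 i q))
                     (trans (ext-pos a i (q ℤ.+ wrap i)) (cong (λ z → a i ℚ.- z) (ℤtoℚ-+ q (wrap i))))

  ext-antitone : ∀ {a} → Descending a → ∀ {u v} → u ℤ.< v → ext a v ℚ.< ext a u
  ext-antitone {a} desc {u} u<v with <⇒≡+suc u<v
  ... | d , refl = go d
    where
    u+x+1≡u+[1+x] : ∀ u x → u ℤ.+ x ℤ.+ 1ℤ ≡ u ℤ.+ (1ℤ ℤ.+ x)
    u+x+1≡u+[1+x] = solve-∀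
    go : ∀ d → ext a (u ℤ.+ + suc d) ℚ.< ext a u
    go zero    = ext-+1-< {a} desc u
    go (suc d) = ℚP.<-trans (subst (λ v → ext a v ℚ.< ext a (u ℤ.+ + suc d)) (u+x+1≡u+[1+x] u (+ suc d))
                              (ext-+1-< {a} desc (u ℤ.+ + suc d)))
                            (go d)

  pos-0 : ∀ c → pos c 0ℤ ≡ + suc (toℕ c)
  pos-0 c = ℤP.+-identityʳ (+ suc (toℕ c))

  pos-1 : ∀ c → pos c 1ℤ ≡ + (suc (toℕ c) + n)
  pos-1 c = cong (λ z → + suc (toℕ c) ℤ.+ z) (ℤP.*-identityˡ (+ n))

  InA0-gap : ∀ {a} → InA0 n a → ∀ {j k} → j Fin.< k → 0ℚ ℚ.< a j ℚ.- a k × a j ℚ.- a k ℚ.< 1ℚ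
  InA0-gap {a} aA {j} {k} j<k =
    <-by-difference (ext-between j 0ℤ k 0ℤ j₀<k₀)
      (solve 2 (λ x y → x :- con 0ℚ :- (y :- con 0ℚ) := x :- y :- con 0ℚ) refl (a j) (a k)) ,
    <-by-difference (ext-between k 0ℤ j 1ℤ k₀<j₁)
      (solve 2 (λ x y → y :- con 0ℚ :- (x :- con 1ℚ) := con 1ℚ :- (x :- y)) refl (a j) (a k))
    where
    ext-between : ∀ c q c' q' → pos c q ℤ.< pos c' q' → a c' ℚ.- ℤtoℚ q' ℚ.< a c ℚ.- ℤtoℚ q
    ext-between c q c' q' lt =
      subst₂ ℚ._<_ (ext-pos a c' q') (ext-pos a c q) (ext-antitone {a} (InA0⇒Descending aA) lt)
    j₀<k₀ : pos j 0ℤ ℤ.< pos k 0ℤ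
    j₀<k₀ = subst₂ ℤ._<_ (sym (pos-0 j)) (sym (pos-0 k)) (ℤ.+<+ (s≤s j<k))
    k₀<j₁ : pos k 0ℤ ℤ.< pos j 1ℤ
    k₀<j₁ = subst₂ ℤ._<_ (sym (pos-0 k)) (sym (pos-1 j))
      (ℤ.+<+ (s≤s (ℕP.≤-trans (FinP.toℕ<n k) (ℕP.m≤n+m n (toℕ j)))))

  InA0⇒Generic : ∀ {a} → InA0 n a → Generic a
  InA0⇒Generic {a} aA j k j<k ℓ eq = ℤP.<-irrefl refl (ℤP.≤-<-trans (ℤP.i<j⇒suc[i]≤j 0<ℓ) ℓ<1)
    where
    0<ℓ : 0ℤ ℤ.< ℓ
    0<ℓ = ℤtoℚ-cancel-< (subst (0ℚ ℚ.<_) eq (proj₁ (InA0-gap aA j<k)))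
    ℓ<1 : ℓ ℤ.< 1ℤ
    ℓ<1 = ℤtoℚ-cancel-< (subst (ℚ._< 1ℚ) eq (proj₂ (InA0-gap aA j<k)))

  InA0-SameSide : ∀ {a b} → InA0 n a → InA0 n b → SameSide a b
  InA0-SameSide aA bA j k j<k ℓ =
    0<d<ℓ∧d'<1⇒d'<ℓ {ℓ = ℓ} (proj₁ (InA0-gap aA j<k)) (proj₂ (InA0-gap bA j<k)) ,
    0<d<ℓ∧d'<1⇒d'<ℓ {ℓ = ℓ} (proj₁ (InA0-gap bA j<k)) (proj₂ (InA0-gap aA j<k))

  SameSide-InA0 : ∀ {a y} → InA0 n a → InV y → Generic y → SameSide a y → InA0 n y
  SameSide-InA0 {a} {y} aA yV gy ay =
    Descending⇒InA0 yV (λ i → SameSide⇒< {x = a} {y} gy ay i (prev i) (wrap i) (InA0⇒Descending aA i))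

  alcove-image : ∀ w {p} → InV p → Generic p → InA0 n (act n w p) → AlcoveIsImage n p (reverse w)
  alcove-image w {p} pV gp a₀A q = from-alcove , to-alcove
    where
    a₀ = act n w p
    from-alcove : InAlcoveOf p q → Σ (Pt n) λ a → InA0 n a × (∀ j → q j ≡ act n (reverse w) a j)
    from-alcove (qV , gq , pq) =
      act n w q ,
      SameSide-InA0 a₀A (InV-act w qV) (Generic-act w gq) (SameSide-act w gp gq pq) ,
      λ j → sym (act-reverse w q j)
    to-alcove : (Σ (Pt n) λ a → InA0 n a × (∀ j → q j ≡ act n (reverse w) a j)) → InAlcoveOf p q
    to-alcove (a , aA , q≗) =
      InV-cong q≗′ (InV-act (reverse w) (proj₁ aA)) ,
      Generic-cong q≗′ (Generic-act (reverse w) (InA0⇒Generic aA)) ,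
      SameSide-cong (act-reverse w p) q≗′
        (SameSide-act (reverse w) (InA0⇒Generic a₀A) (InA0⇒Generic aA) (InA0-SameSide a₀A aA))
      where
      q≗′ : act n (reverse w) a ≗ q
      q≗′ j = sym (q≗ j)

  -- The region D

  StepNonincreasing : ℕ → Pt n → Set
  StepNonincreasing m y = ∀ u → ext y (u ℤ.+ + m) ℚ.≤ ext y u

  StepDecreasing : ℕ → Pt n → Set
  StepDecreasing m y = ∀ u → ext y (u ℤ.+ + m) ℚ.< ext y u

  pos-+ : ∀ {c c'} q s t → toℕ c + s ≡ toℕ c' + t * n → pos c q ℤ.+ + s ≡ pos c' (q ℤ.+ + t)
  pos-+ {c} {c'} q s t eq = begin
    + suc (toℕ c) ℤ.+ q ℤ.* + n ℤ.+ + s           ≡⟨ a+b+s≡a+s+b (+ suc (toℕ c)) (q ℤ.* + n) (+ s) ⟩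
    + suc (toℕ c + s) ℤ.+ q ℤ.* + n               ≡⟨ cong (λ z → + suc z ℤ.+ q ℤ.* + n) eq ⟩
    + suc (toℕ c') ℤ.+ + (t * n) ℤ.+ q ℤ.* + n    ≡⟨ cong (λ z → + suc (toℕ c') ℤ.+ z ℤ.+ q ℤ.* + n) (ℤP.pos-* t n) ⟩
    + suc (toℕ c') ℤ.+ + t ℤ.* + n ℤ.+ q ℤ.* + n  ≡⟨ a+tx+qx≡a+[q+t]x (+ suc (toℕ c')) (+ t) q (+ n) ⟩
    + suc (toℕ c') ℤ.+ (q ℤ.+ + t) ℤ.* + n        ∎
    where
    open ≡-Reasoning
    a+b+s≡a+s+b : ∀ a b s → a ℤ.+ b ℤ.+ s ≡ a ℤ.+ s ℤ.+ b
    a+b+s≡a+s+b = solve-∀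
    a+tx+qx≡a+[q+t]x : ∀ a t q x → a ℤ.+ t ℤ.* x ℤ.+ q ℤ.* x ≡ a ℤ.+ (q ℤ.+ t) ℤ.* x
    a+tx+qx≡a+[q+t]x = solve-∀

  ext-pos-+ : ∀ y {c c'} q s t → toℕ c + s ≡ toℕ c' + t * n →
    ext y (pos c q ℤ.+ + s) ≡ y c' ℚ.- (ℤtoℚ q ℚ.+ ℤtoℚ (+ t))
  ext-pos-+ y {c' = c'} q s t eq =
    trans (cong (ext y) (pos-+ q s t eq)) (trans (ext-pos y c' (q ℤ.+ + t)) (cong (λ z → y c' ℚ.- z) (ℤtoℚ-+ q (+ t))))

  ext-+-≤⇒ : ∀ y {c c'} q s t → toℕ c + s ≡ toℕ c' + t * n →
    ext y (pos c q ℤ.+ + s) ℚ.≤ ext y (pos c q) → y c' ℚ.- y c ℚ.≤ ℤtoℚ (+ t)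
  ext-+-≤⇒ y {c} {c'} q s t eq le =
    ≤-by-difference (subst₂ ℚ._≤_ (ext-pos-+ y q s t eq) (ext-pos y c q) le)
      (solve 4 (λ a b Q T → a :- Q :- (b :- (Q :+ T)) := T :- (b :- a)) refl (y c) (y c') (ℤtoℚ q) (ℤtoℚ (+ t)))

  ext-+-≤⇐ : ∀ y {c c'} q s t → toℕ c + s ≡ toℕ c' + t * n →
    y c' ℚ.- y c ℚ.≤ ℤtoℚ (+ t) → ext y (pos c q ℤ.+ + s) ℚ.≤ ext y (pos c q)
  ext-+-≤⇐ y {c} {c'} q s t eq le =
    subst₂ ℚ._≤_ (sym (ext-pos-+ y q s t eq)) (sym (ext-pos y c q)) (≤-by-difference le
      (solve 4 (λ a b Q T → T :- (b :- a) := a :- Q :- (b :- (Q :+ T))) refl (y c) (y c') (ℤtoℚ q) (ℤtoℚ (+ t))))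

  private
    a+[x+r]≡a+r+x : ∀ a r x → a + (x + r) ≡ a + r + x
    a+[x+r]≡a+r+x = ℕ-Ring.solve-∀

    within : ∀ {a b} k r → a + r ≡ b → a + (k * n + r) ≡ b + k * n
    within {a} k r refl = a+[x+r]≡a+r+x a r (k * n)

    across : ∀ {a b} k r → b + n ≡ a + r → a + (k * n + r) ≡ b + (k + 1) * n
    across {a} {b} k r eq = begin
      a + (k * n + r)   ≡⟨ a+[x+r]≡a+r+x a r (k * n) ⟩
      a + r + k * n     ≡⟨ cong (_+ k * n) eq ⟨
      b + n + k * n     ≡⟨ b+n+kn≡b+[k+1]n b n k ⟩
      b + (k + 1) * n   ∎
      where
      open ≡-Reasoning
      b+n+kn≡b+[k+1]n : ∀ b n k → b + n + k * n ≡ b + (k + 1) * n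
      b+n+kn≡b+[k+1]n = ℕ-Ring.solve-∀

    -k≤⇒≤k : ∀ {a b K} → ℚ.- K ℚ.≤ a ℚ.- b → b ℚ.- a ℚ.≤ K
    -k≤⇒≤k {a} {b} {K} le = ≤-by-difference le (solve 3 (λ a b K → a :- b :- (:- K) := K :- (b :- a)) refl a b K)

    ≤k⇒-k≤ : ∀ {a b K} → b ℚ.- a ℚ.≤ K → ℚ.- K ℚ.≤ a ℚ.- b
    ≤k⇒-k≤ {a} {b} {K} le = ≤-by-difference le (solve 3 (λ a b K → K :- (b :- a) := a :- b :- (:- K)) refl a b K)

  InD⇒StepNonincreasing : ∀ {k r y} → r < n → InD n k r y → StepNonincreasing (k * n + r) y
  InD⇒StepNonincreasing {k} {r} {y} r<n (D₁ , D₂) u with positioned u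
  ... | position c q with toℕ c + r ℕ.<? n
  ...   | yes c+r<n = ext-+-≤⇐ y q (k * n + r) k (within k r c+r≡c') (-k≤⇒≤k {y c} {y c'} (D₁ c c' c+r≡c'))
    where
    c' = fromℕ< c+r<n
    c+r≡c' : toℕ c + r ≡ toℕ c'
    c+r≡c' = sym (FinP.toℕ-fromℕ< c+r<n)
  ...   | no c+r≮n = ext-+-≤⇐ y q (k * n + r) (k + 1) (across k r c'+n≡c+r) (D₂ c c' c'+n≡c+r)
    where
    c+r∸n<n : toℕ c + r ∸ n < n
    c+r∸n<n = ℕP.m<n+o⇒m∸n<o (toℕ c + r) n (ℕP.+-mono-< (FinP.toℕ<n c) r<n)
    c' = fromℕ< c+r∸n<n
    c'+n≡c+r : toℕ c' + n ≡ toℕ c + r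
    c'+n≡c+r = trans (cong (_+ n) (FinP.toℕ-fromℕ< c+r∸n<n)) (ℕP.m∸n+n≡m (ℕP.≮⇒≥ c+r≮n))

  StepNonincreasing⇒InD : ∀ {k r y} → StepNonincreasing (k * n + r) y → InD n k r y
  StepNonincreasing⇒InD {k} {r} {y} step =
    (λ i j i+r≡j → ≤k⇒-k≤ {y i} {y j} (ext-+-≤⇒ y {i} {j} 0ℤ (k * n + r) k (within k r i+r≡j) (step (pos i 0ℤ)))) ,
    (λ i j j+n≡i+r → ext-+-≤⇒ y {i} {j} 0ℤ (k * n + r) (k + 1) (across k r j+n≡i+r) (step (pos i 0ℤ)))

  Restricted⇒StepDecreasing : ∀ {m} w {a} → Restricted m (perm n w) → InA0 n a → StepDecreasing m (act n w a)
  Restricted⇒StepDecreasing {m} w {a} ω-restricted aA x =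
    subst₂ ℚ._<_ (ext-reverse (x ℤ.+ + m)) (ext-reverse x)
      (ext-antitone {a} (InA0⇒Descending aA) (ω-restricted _ _ x (perm-reverse w x) (perm-reverse w (x ℤ.+ + m))))
    where
    ext-reverse : ∀ v → ext a (perm n (reverse w) v) ≡ ext (act n w a) v
    ext-reverse v = trans (sym (ext-act w a (perm n (reverse w) v))) (cong (ext (act n w a)) (perm-reverse w v))

  StepNonincreasing⇒Restricted : ∀ {m} w {a} → 0 < m → InA0 n a → StepNonincreasing m (act n w a) →
    Restricted m (perm n w)
  StepNonincreasing⇒Restricted {m} w {a} 0<m aA step b c x ωb≡x ωc≡x+m with ℤP.<-cmp b c
  ... | tri< b<c _ _  = b<c
  ... | tri≈ _ refl _ = ⊥-elim (x+m≢x x 0<m (trans (sym ωc≡x+m) ωb≡x))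
  ... | tri> _ _ c<b  = ⊥-elim (ℚP.<-irrefl refl (begin-strict
    ext a b                        <⟨ ext-antitone {a} (InA0⇒Descending aA) c<b ⟩
    ext a c                        ≡⟨ ext-act w a c ⟨
    ext (act n w a) (perm n w c)   ≡⟨ cong (ext (act n w a)) ωc≡x+m ⟩
    ext (act n w a) (x ℤ.+ + m)    ≤⟨ step x ⟩
    ext (act n w a) x              ≡⟨ cong (ext (act n w a)) ωb≡x ⟨
    ext (act n w a) (perm n w b)   ≡⟨ ext-act w a b ⟩
    ext a b                        ∎))
    where open ℚP.≤-Reasoning

  -- Descent to the fundamental alcove

  below : Fin n → Fin n → ℤ
  below j k with j Fin.<? k
  ... | yes _ = 1ℤ
  ... | no _  = 0ℤ

  below-< : ∀ {j k} → j Fin.< k → below j k ≡ 1ℤ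
  below-< {j} {k} j<k with j Fin.<? k
  ... | yes _  = refl
  ... | no j≮k = ⊥-elim (j≮k j<k)

  below-≮ : ∀ {j k} → ¬ j Fin.< k → below j k ≡ 0ℤ
  below-≮ {j} {k} j≮k with j Fin.<? k
  ... | yes j<k = ⊥-elim (j≮k j<k)
  ... | no _    = refl

  below-≡ : ∀ {j k j' k'} → (j Fin.< k → j' Fin.< k') → (j' Fin.< k' → j Fin.< k) → below j k ≡ below j' k'
  below-≡ {j} {k} {j'} {k'} ⇒ ⇐ with j Fin.<? k
  ... | yes j<k = sym (below-< {j'} {k'} (⇒ j<k))
  ... | no j≮k  = sym (below-≮ {j'} {k'} (j≮k ∘ ⇐))

  below-irrefl : ∀ j → below j j ≡ 0ℤ
  below-irrefl j = below-≮ {j} {j} (FinP.<-irrefl refl)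

  toℕ≤toℕ-last : ∀ k → toℕ k ℕ.≤ toℕ last
  toℕ≤toℕ-last k = subst (toℕ k ℕ.≤_) (sym (FinP.toℕ-fromℕ (suc N))) (ℕ.s≤s⁻¹ (FinP.toℕ<n k))

  below-prev-self : ∀ i → below (prev i) i ≡ 1ℤ ℤ.- wrap i
  below-prev-self zero    = below-≮ {last} {zero} λ ()
  below-prev-self (suc t) = below-< {inject₁ t} {suc t} (s≤s (ℕP.≤-reflexive (FinP.toℕ-inject₁ t)))

  below-self-prev : ∀ i → below i (prev i) ≡ wrap i
  below-self-prev zero    = below-< {zero} {last} (s≤s z≤n)
  below-self-prev (suc t) = below-≮ {suc t} {inject₁ t} λ t+1<t →
    ℕP.<-asym (subst (suc (toℕ t) ℕ.<_) (FinP.toℕ-inject₁ t) t+1<t) (ℕP.n<1+n (toℕ t))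

  below-prev-other : ∀ {i k} → k ≢ prev i → k ≢ i → below (prev i) k ≡ below i k ℤ.- wrap i
  below-prev-other {zero} {k} k≢last k≢0 =
    trans (below-≮ {last} {k} λ last<k → ℕP.<-irrefl refl (ℕP.<-≤-trans last<k (toℕ≤toℕ-last k)))
          (sym (cong (ℤ._- 1ℤ) (below-< {zero} {k} (ℕP.n≢0⇒n>0 (k≢0 ∘ FinP.toℕ-injective)))))
  below-prev-other {suc t} {k} k≢t k≢t+1 = trans (below-≡ {inject₁ t} {k} ⇒ ⇐) (sym (ℤP.+-identityʳ _))
    where
    ⇒ : inject₁ t Fin.< k → suc t Fin.< k
    ⇒ t<k = ℕP.≤∧≢⇒< (subst (ℕ._< toℕ k) (FinP.toℕ-inject₁ t) t<k) (k≢t+1 ∘ FinP.toℕ-injective ∘ sym)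
    ⇐ : suc t Fin.< k → inject₁ t Fin.< k
    ⇐ t+1<k = subst (ℕ._< toℕ k) (sym (FinP.toℕ-inject₁ t)) (ℕP.<-trans (ℕP.n<1+n (toℕ t)) t+1<k)

  below-other-prev : ∀ {i j} → j ≢ prev i → j ≢ i → below j (prev i) ≡ below j i ℤ.+ wrap i
  below-other-prev {zero} {j} j≢last j≢0 =
    trans (below-< {j} {last} (ℕP.≤∧≢⇒< (toℕ≤toℕ-last j) (j≢last ∘ FinP.toℕ-injective)))
          (sym (cong (ℤ._+ 1ℤ) (below-≮ {j} {zero} λ ())))
  below-other-prev {suc t} {j} j≢t j≢t+1 = trans (below-≡ {j} {inject₁ t} ⇒ ⇐) (sym (ℤP.+-identityʳ _))
    where
    ⇒ : j Fin.< inject₁ t → j Fin.< suc t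
    ⇒ j<t = ℕP.m<n⇒m<1+n (subst (toℕ j ℕ.<_) (FinP.toℕ-inject₁ t) j<t)
    ⇐ : j Fin.< suc t → j Fin.< inject₁ t
    ⇐ j<t+1 = subst (toℕ j ℕ.<_) (sym (FinP.toℕ-inject₁ t))
      (ℕP.≤∧≢⇒< (ℕ.s≤s⁻¹ j<t+1) (j≢t ∘ FinP.toℕ-injective ∘ (λ eq → trans eq (sym (FinP.toℕ-inject₁ t)))))

  twist : Fin n → Fin n → Fin n → ℤ
  twist i j k = shift i k ℤ.- shift i j ℤ.+ below (σ i j) (σ i k)

  twist-forward : ∀ i → twist i (prev i) i ≡ ℤ.- wrap i
  twist-forward i rewrite shift-self i | shift-prev i | transpose-matchˡ (prev i) i
    | transpose-matchʳ (prev i) i | below-self-prev i = -w-w+w≡-w (wrap i)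
    where
    -w-w+w≡-w : ∀ w → ℤ.- w ℤ.- w ℤ.+ w ≡ ℤ.- w
    -w-w+w≡-w = solve-∀

  twist-backward : ∀ i → twist i i (prev i) ≡ 1ℤ ℤ.+ wrap i
  twist-backward i rewrite shift-self i | shift-prev i | transpose-matchˡ (prev i) i
    | transpose-matchʳ (prev i) i | below-prev-self i = w-[-w]+[1-w]≡1+w (wrap i)
    where
    w-[-w]+[1-w]≡1+w : ∀ w → w ℤ.- ℤ.- w ℤ.+ (1ℤ ℤ.- w) ≡ 1ℤ ℤ.+ w
    w-[-w]+[1-w]≡1+w = solve-∀

  private
    s-s+0≡0 : ∀ s → s ℤ.- s ℤ.+ 0ℤ ≡ 0ℤ
    s-s+0≡0 = solve-∀
    0-w+b≡b-w : ∀ w b → 0ℤ ℤ.- w ℤ.+ b ≡ b ℤ.- w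
    0-w+b≡b-w = solve-∀
    0-[-w]+[b-w]≡b : ∀ w b → 0ℤ ℤ.- ℤ.- w ℤ.+ (b ℤ.- w) ≡ b
    0-[-w]+[b-w]≡b = solve-∀
    w-0+b≡b+w : ∀ w b → w ℤ.- 0ℤ ℤ.+ b ≡ b ℤ.+ w
    w-0+b≡b+w = solve-∀
    -w-0+[b+w]≡b : ∀ w b → ℤ.- w ℤ.- 0ℤ ℤ.+ (b ℤ.+ w) ≡ b
    -w-0+[b+w]≡b = solve-∀

  twist-other : ∀ i {j k} → ¬ (j ≡ prev i × k ≡ i) → ¬ (j ≡ i × k ≡ prev i) → twist i j k ≡ below j k
  twist-other i {j} {k} ¬fwd ¬bwd with place (prev i) i j | place (prev i) i k
  ... | at-left | at-left
    rewrite shift-prev i | transpose-matchˡ (prev i) i | below-irrefl i | below-irrefl (prev i) = s-s+0≡0 (wrap i)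
  ... | at-left | at-right = ⊥-elim (¬fwd (refl , refl))
  ... | at-left | elsewhere k≢p k≢i
    rewrite shift-prev i | shift-other k≢p k≢i | transpose-matchˡ (prev i) i | transpose-other k≢p k≢i
          | below-prev-other k≢p k≢i = 0-w+b≡b-w (wrap i) (below i k)
  ... | at-right | at-left = ⊥-elim (¬bwd (refl , refl))
  ... | at-right | at-right
    rewrite shift-self i | transpose-matchʳ (prev i) i | below-irrefl i | below-irrefl (prev i) = s-s+0≡0 (ℤ.- wrap i)
  ... | at-right | elsewhere k≢p k≢i
    rewrite shift-self i | shift-other k≢p k≢i | transpose-matchʳ (prev i) i | transpose-other k≢p k≢i
          | below-prev-other k≢p k≢i = 0-[-w]+[b-w]≡b (wrap i) (below i k)
  ... | elsewhere j≢p j≢i | at-left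
    rewrite shift-prev i | shift-other j≢p j≢i | transpose-matchˡ (prev i) i | transpose-other j≢p j≢i
          | below-other-prev j≢p j≢i = w-0+b≡b+w (wrap i) (below j i)
  ... | elsewhere j≢p j≢i | at-right
    rewrite shift-self i | shift-other j≢p j≢i | transpose-matchʳ (prev i) i | transpose-other j≢p j≢i
          | below-other-prev j≢p j≢i = -w-0+[b+w]≡b (wrap i) (below j i)
  ... | elsewhere j≢p j≢i | elsewhere k≢p k≢i
    rewrite shift-other j≢p j≢i | shift-other k≢p k≢i | transpose-other j≢p j≢i | transpose-other k≢p k≢i =
    ℤP.+-identityˡ (below j k)

  gap : Pt n → Fin n → Fin n → ℚ
  gap y j k = y k ℚ.- y j ℚ.+ ℤtoℚ (below j k)

  gap-sAct : ∀ i y j k → gap (sAct n i y) (σ i j) (σ i k) ≡ y k ℚ.- y j ℚ.+ ℤtoℚ (twist i j k)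
  gap-sAct i y j k = begin
    sAct n i y (σ i k) ℚ.- sAct n i y (σ i j) ℚ.+ B      ≡⟨ cong₂ (λ a b → a ℚ.- b ℚ.+ B) (sAct-σ i y k) (sAct-σ i y j) ⟩
    y k ℚ.+ S ℚ.- (y j ℚ.+ T) ℚ.+ B                      ≡⟨ solve 5 (λ a b S T B → a :+ S :- (b :+ T) :+ B := a :- b :+ (S :- T :+ B))
                                                              refl (y k) (y j) S T B ⟩
    y k ℚ.- y j ℚ.+ (S ℚ.- T ℚ.+ B)                      ≡⟨ cong (λ z → y k ℚ.- y j ℚ.+ z) twist-ℚ ⟨
    y k ℚ.- y j ℚ.+ ℤtoℚ (twist i j k)                   ∎
    where
    open ≡-Reasoning
    S = ℤtoℚ (shift i k)
    T = ℤtoℚ (shift i j)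
    B = ℤtoℚ (below (σ i j) (σ i k))
    twist-ℚ : ℤtoℚ (twist i j k) ≡ S ℚ.- T ℚ.+ B
    twist-ℚ = trans (ℤtoℚ-+ (shift i k ℤ.- shift i j) _) (cong (ℚ._+ B) (ℤtoℚ-- (shift i k) (shift i j)))

  -- For generic y this counts the hyperplanes x_j − x_k = ℓ separating y from A₀.
  potential : Pt n → ℕ
  potential y = ℕΣ.sum λ j → ℕΣ.sum λ k → floor⁺ (gap y j k)

  Ascent : Fin n → Pt n → Set
  Ascent i y = ℤtoℚ (wrap i) ℚ.< y i ℚ.- y (prev i)

  module _ {i : Fin n} {y : Pt n} (ascent : Ascent i y) where

    private
      y' = sAct n i y
      X  = y i ℚ.- y (prev i) ℚ.- ℤtoℚ (wrap i)

      0<X : 0ℚ ℚ.< X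
      0<X = <-by-difference ascent (solve 2 (λ d W → d :- W := d :- W :- con 0ℚ) refl (y i ℚ.- y (prev i)) (ℤtoℚ (wrap i)))

      gap-forward : gap y (prev i) i ≡ 1ℚ ℚ.+ X
      gap-forward = begin
        d ℚ.+ ℤtoℚ (below (prev i) i)   ≡⟨ cong (λ z → d ℚ.+ ℤtoℚ z) (below-prev-self i) ⟩
        d ℚ.+ ℤtoℚ (1ℤ ℤ.- wrap i)      ≡⟨ cong (d ℚ.+_) (ℤtoℚ-- 1ℤ (wrap i)) ⟩
        d ℚ.+ (1ℚ ℚ.- W)                ≡⟨ solve 2 (λ d W → d :+ (con 1ℚ :- W) := con 1ℚ :+ (d :- W)) refl d W ⟩
        1ℚ ℚ.+ X                        ∎
        where
        open ≡-Reasoning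
        d = y i ℚ.- y (prev i)
        W = ℤtoℚ (wrap i)

      gap-sAct-forward : gap y' (σ i (prev i)) (σ i i) ≡ X
      gap-sAct-forward = trans (gap-sAct i y (prev i) i)
        (trans (cong (λ z → y i ℚ.- y (prev i) ℚ.+ ℤtoℚ z) (twist-forward i))
               (cong (λ z → y i ℚ.- y (prev i) ℚ.+ z) (ℤtoℚ-neg (wrap i))))

      gap-sAct-backward : gap y' (σ i i) (σ i (prev i)) ≡ 1ℚ ℚ.- X
      gap-sAct-backward = begin
        gap y' (σ i i) (σ i (prev i))      ≡⟨ gap-sAct i y i (prev i) ⟩
        d ℚ.+ ℤtoℚ (twist i i (prev i))    ≡⟨ cong (λ z → d ℚ.+ ℤtoℚ z) (twist-backward i) ⟩
        d ℚ.+ ℤtoℚ (1ℤ ℤ.+ wrap i)         ≡⟨ cong (d ℚ.+_) (ℤtoℚ-+ 1ℤ (wrap i)) ⟩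
        d ℚ.+ (1ℚ ℚ.+ W)                   ≡⟨ solve 3 (λ a b W → b :- a :+ (con 1ℚ :+ W) := con 1ℚ :- (a :- b :- W)) refl (y i) (y (prev i)) W ⟩
        1ℚ ℚ.- X                           ∎
        where
        open ≡-Reasoning
        d = y (prev i) ℚ.- y i
        W = ℤtoℚ (wrap i)

    floor⁺-gap-< : floor⁺ (gap y' (σ i (prev i)) (σ i i)) < floor⁺ (gap y (prev i) i)
    floor⁺-gap-< = begin-strict
      floor⁺ (gap y' (σ i (prev i)) (σ i i)) ≡⟨ cong floor⁺ gap-sAct-forward ⟩
      floor⁺ X                               <⟨ ℕP.n<1+n (floor⁺ X) ⟩
      suc (floor⁺ X)                         ≡⟨ floor⁺-1+ {X} (ℚP.<⇒≤ 0<X) ⟨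
      floor⁺ (1ℚ ℚ.+ X)                      ≡⟨ cong floor⁺ gap-forward ⟨
      floor⁺ (gap y (prev i) i)              ∎
      where open ℕP.≤-Reasoning

    floor⁺-gap-≤ : ∀ j k → floor⁺ (gap y' (σ i j) (σ i k)) ≤ floor⁺ (gap y j k)
    floor⁺-gap-≤ j k with (j Fin.≟ prev i) ×-dec (k Fin.≟ i) | (j Fin.≟ i) ×-dec (k Fin.≟ prev i)
    ... | yes (refl , refl) | _ = ℕP.<⇒≤ floor⁺-gap-<
    ... | no _ | yes (refl , refl) = begin
      floor⁺ (gap y' (σ i i) (σ i (prev i))) ≡⟨ cong floor⁺ gap-sAct-backward ⟩
      floor⁺ (1ℚ ℚ.- X)                      ≡⟨ floor⁺-<1 {1ℚ ℚ.- X} 1-X<1 ⟩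
      0                                      ≤⟨ z≤n ⟩
      floor⁺ (gap y i (prev i))              ∎
      where
      open ℕP.≤-Reasoning
      1-X<1 : 1ℚ ℚ.- X ℚ.< 1ℚ
      1-X<1 = <-by-difference 0<X (solve 1 (λ X → X :- con 0ℚ := con 1ℚ :- (con 1ℚ :- X)) refl X)
    ... | no ¬fwd | no ¬bwd = ℕP.≤-reflexive (cong floor⁺
        (trans (gap-sAct i y j k) (cong (λ z → y k ℚ.- y j ℚ.+ ℤtoℚ z) (twist-other i ¬fwd ¬bwd))))

    potential-sAct-< : potential y' < potential y
    potential-sAct-< = begin-strict
      potential y'             ≡⟨ reindex ⟩
      ℕΣ.sum (λ j → ℕΣ.sum (G' j)) <⟨ sum-mono-< (λ j → ℕΣ.sum (G' j)) (λ j → ℕΣ.sum (G j))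
                                       (λ j → sum-mono-≤ (G' j) (G j) (floor⁺-gap-≤ j))
                                       (prev i) (sum-mono-< (G' (prev i)) (G (prev i)) (floor⁺-gap-≤ (prev i)) i floor⁺-gap-<) ⟩
      potential y              ∎
      where
      open ℕP.≤-Reasoning
      π = Permutation.transpose (prev i) i
      G G' : Fin n → Fin n → ℕ
      G j k = floor⁺ (gap y j k)
      G' j k = floor⁺ (gap y' (σ i j) (σ i k))
      reindex : potential y' ≡ ℕΣ.sum (λ j → ℕΣ.sum (G' j))
      reindex = trans (ℕΣ.sum-permute (λ j → ℕΣ.sum λ k → floor⁺ (gap y' j k)) π)
                      (ℕΣ.sum-cong-≗ (λ j → ℕΣ.sum-permute (λ k → floor⁺ (gap y' (σ i j) k)) π))

  descend : ∀ y → Acc _<_ (potential y) → InV y → Generic y → Σ (List (Fin n)) λ w → InA0 n (act n w y)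
  descend y (acc smaller) yV gy = step (FinP.any? (λ i → ℤtoℚ (wrap i) ℚ.<? y i ℚ.- y (prev i)))
    where
    step : Dec (Σ (Fin n) λ i → Ascent i y) → Σ (List (Fin n)) λ w → InA0 n (act n w y)
    step (yes (i , ascent)) =
      extend (descend (sAct n i y) (smaller (potential-sAct-< {i} {y} ascent)) (InV-sAct i yV) (Generic-sAct i gy))
      where
      extend : (Σ (List (Fin n)) λ w → InA0 n (act n w (sAct n i y))) → Σ (List (Fin n)) λ w → InA0 n (act n w y)
      extend (w , A) = w ++ i ∷ [] , subst (InA0 n) (sym (act-++ w (i ∷ []) y)) A
    step (no no-ascent) = [] , Descending⇒InA0 yV descending
      where
      descending : Descending y
      descending i = ≤∧≢⇒< (ℚP.≮⇒≥ (λ ascent → no-ascent (i , ascent)))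
                            (Generic⇒≢ {x = y} gy (prev≢ i ∘ sym) (wrap i))

  image⇒AlcoveInD : ∀ {k r p} w → Restricted (k * n + r) (perm n w) → AlcoveIsImage n p w → AlcoveInD n k r p
  image⇒AlcoveInD {k} {r} w ω-restricted image q qA with proj₁ (image q) qA
  ... | a , aA , q≗ωa = StepNonincreasing⇒InD {k} {r} {q} λ u →
    subst₂ ℚ._≤_ (ext-cong (sym ∘ q≗ωa) (u ℤ.+ + (k * n + r))) (ext-cong (sym ∘ q≗ωa) u)
      (ℚP.<⇒≤ (Restricted⇒StepDecreasing {k * n + r} w {a} ω-restricted aA u))

  AlcoveInD⇒image : ∀ {k r p} → 0 < k * n + r → r < n → InV p → Generic p → AlcoveInD n k r p →
    Σ (List (Fin n)) λ w → Restricted (k * n + r) (perm n w) × AlcoveIsImage n p w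
  AlcoveInD⇒image {k} {r} {p} 0<m r<n pV gp pD with descend p (ℕInd.<-wellFounded (potential p)) pV gp
  ... | w , a₀A =
    reverse w , StepNonincreasing⇒Restricted {k * n + r} (reverse w) {act n w p} 0<m a₀A step , alcove-image w pV gp a₀A
    where
    p≗ : p ≗ act n (reverse w) (act n w p)
    p≗ j = sym (act-reverse w p j)
    step : StepNonincreasing (k * n + r) (act n (reverse w) (act n w p))
    step u = subst₂ ℚ._≤_ (ext-cong p≗ (u ℤ.+ + (k * n + r))) (ext-cong p≗ u)
      (InD⇒StepNonincreasing {k} {r} {p} r<n (pD p (pV , gp , SameSide-refl {p = p})) u)

mainTheorem16 : (m n k r : ℕ) → 2 ≤ n → 0 < m → Coprime m n →
    m ≡ k * n + r → 0 < r → r < n →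
    (p : Pt n) → InV p → Generic p →
    ((Σ (List (Fin n)) λ w → Restricted m (perm n w) × AlcoveIsImage n p w)
      → AlcoveInD n k r p) ×
    (AlcoveInD n k r p
      → Σ (List (Fin n)) λ w → Restricted m (perm n w) × AlcoveIsImage n p w)
mainTheorem16 m (suc (suc N)) k r (s≤s (s≤s z≤n)) 0<m _ refl _ r<n p pV gp =
  (λ (w , ω-restricted , image) → image⇒AlcoveInD {N} {k} {r} {p} w ω-restricted image) ,
  AlcoveInD⇒image {N} {k} {r} {p} 0<m r<n pV gp
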